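{- Let $Q$ be a semi-Eulerian poset of rank $r+1$, let $s=\lfloor r/2\rfloor$, and let $y=x-1$. For integers $k$ put $\gamma_k=(-1)^{r-k}\binom{r+1}{k}e_Q(\hat0,\hat1)$. Then \[ \hat g(Q,x)+y\,\hat h(Q,x)=x^{r+1}\hat g(Q,1/x)+\sum_{k=r-s+1}^{r+1}\gamma_k x^k+\delta, \] where $\delta=0$ if $r$ is even and $\delta=\tfrac12\gamma_{r-s}x^{r-s}$ if $r$ is odd.
   Context: Posets are finite and graded with unique $\hat0$, $\hat1$, rank function $\rho$ ($\rho(\hat0)=0$), rank $\rho(\hat1)$, and Möbius function $\mu$. $e_Q(\hat0,\hat1)=\mu_Q(\hat0,\hat1)-(-1)^{\rho(Q)}$. $Q$ is semi-Eulerian if $\mu_Q(a,b)=(-1)^{\rho(b)-\rho(a)}$ for all intervals $[a,b]\ne[\hat0,\hat1]$. Toric polynomials: for the one-element poset, $\hat h=\hat g=1$. For $P$ of rank $d+1\ge1$, $\hat h(P,x)=\sum_{t\in P,\ t\ne\hat1}\hat g([\hat0,t],x)(x-1)^{d-\rho(t)}$; writing $\hat h(P,x)=\sum_{i=0}^d\hat h_i(P)x^{d-i}$, one sets $\hat g(P,x)=\hat h_d+\sum_{m=1}^{\lfloor d/2\rfloor}(\hat h_{d-m}-\hat h_{d-m+1})x^m$. -}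

module Defs where

open import Data.Bool using (Bool; true; false; T; not; _∧_; if_then_else_)
open import Data.Nat as ℕ using (ℕ; zero; suc; _∸_; ⌊_/2⌋)
open import Data.Nat.Combinatorics using (_C_)
open import Data.Integer as ℤ using (ℤ; +_; -_; _+_; _*_; _-_)
open import Data.Fin using (Fin; _≟_)
open import Data.Product using (_×_)
open import Relation.Nullary using (¬_)
open import Relation.Nullary.Decidable using (⌊_⌋)
open import Relation.Binary.PropositionalEquality using (_≡_; _≢_)

Lt : ∀ {n} → (Fin n → Fin n → Bool) → Fin n → Fin n → Set
Lt le a b = T (le a b) × a ≢ b

Covers : ∀ {n} → (Fin n → Fin n → Bool) → Fin n → Fin n → Set
Covers le a b = Lt le a b × (∀ c → Lt le a c → ¬ Lt le c b)

record GradedPoset : Set where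
  field
    card    : ℕ
    le      : Fin card → Fin card → Bool
    le-refl  : ∀ a → T (le a a)
    le-antisym : ∀ a b → T (le a b) → T (le b a) → a ≡ b
    le-trans : ∀ a b c → T (le a b) → T (le b c) → T (le a c)
    bot top : Fin card
    bot-le  : ∀ a → T (le bot a)
    le-top  : ∀ a → T (le a top)
    rank    : Fin card → ℕ
    rank-bot : rank bot ≡ 0
    rank-cover : ∀ a b → Covers le a b → rank b ≡ suc (rank a)

-- Sums and polynomials (coefficient functions; x^k ↦ p k)

sumFin : ∀ {n} → (Fin n → ℤ) → ℤ
sumFin {zero}  f = + 0
sumFin {suc n} f = f Fin.zero + sumFin (λ i → f (Fin.suc i))

sumBelow : ℕ → (ℕ → ℤ) → ℤ
sumBelow zero    f = + 0
sumBelow (suc k) f = sumBelow k f + f k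

Poly : Set
Poly = ℕ → ℤ

pzero : Poly
pzero _ = + 0

pone : Poly
pone zero    = + 1
pone (suc _) = + 0

xpow : ℕ → Poly
xpow m k = if ⌊ m ℕ.≟ k ⌋ then + 1 else + 0

_⊕_ : Poly → Poly → Poly
(p ⊕ q) k = p k + q k

_⊗_ : Poly → Poly → Poly
(p ⊗ q) k = sumBelow (suc k) (λ i → p i * q (k ∸ i))

psum : ∀ {n} → (Fin n → Poly) → Poly
psum f k = sumFin (λ t → f t k)

xm1 : Poly
xm1 zero          = - (+ 1)
xm1 (suc zero)    = + 1
xm1 (suc (suc _)) = + 0

ppow : Poly → ℕ → Poly
ppow p zero    = pone
ppow p (suc j) = p ⊗ ppow p j

sgn : ℕ → ℤ
sgn zero    = + 1
sgn (suc k) = - sgn k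

-- ĝ from ĥ: for ĥ(x) = Σ_{i=0}^d ĥ_i x^{d-i}  (so ĥ_i = coefficient of x^{d-i}),
-- ĝ(x) = ĥ_d + Σ_{m=1}^{⌊d/2⌋} (ĥ_{d-m} - ĥ_{d-m+1}) x^m.
gFromH : ℕ → Poly → Poly
gFromH d h zero    = hc d
  where hc : ℕ → ℤ
        hc i = h (d ∸ i)
gFromH d h (suc m') =
  if suc m' ℕ.≤ᵇ ⌊ d /2⌋ then hc (d ∸ suc m') - hc (suc (d ∸ suc m')) else + 0
  where hc : ℕ → ℤ
        hc i = h (d ∸ i)

-- The interval [a,b] is graded with rank function ρ - ρ(a), so it has rank ρ(b) - ρ(a).
-- The first ℕ argument is fuel for termination only; with fuel ≥ ρ(b) - ρ(a)
-- the result does not depend on it.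

module _ (P : GradedPoset) where
  open GradedPoset P

  _==_ : Fin card → Fin card → Bool
  a == b = ⌊ a ≟ b ⌋

  inHalfOpen : Fin card → Fin card → Fin card → Bool
  inHalfOpen a t b = le a t ∧ (le t b ∧ not (t == b))

  mutual
    hFuel : ℕ → Fin card → Fin card → Poly
    hFuel m a b = psum (λ t → if inHalfOpen a t b
                                 then gFuel m a t ⊗ ppow xm1 ((rank b ∸ rank a ∸ 1) ∸ (rank t ∸ rank a))
                                 else pzero)

    gFuel : ℕ → Fin card → Fin card → Poly
    gFuel zero    a b = pone
    gFuel (suc m) a b with rank b ∸ rank a
    ... | zero  = pone
    ... | suc d = gFromH d (hFuel m a b)

  hHat : Fin card → Fin card → Poly
  hHat a b = hFuel (rank b ∸ rank a) a b

  gHat : Fin card → Fin card → Poly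
  gHat a b = gFuel (rank b ∸ rank a) a b

  muFuel : ℕ → Fin card → Fin card → ℤ
  muFuel zero    a b = if a == b then + 1 else + 0
  muFuel (suc m) a b =
    if a == b then + 1
    else if le a b then - sumFin (λ c → if inHalfOpen a c b then muFuel m a c else + 0)
    else + 0

  mu : Fin card → Fin card → ℤ
  mu a b = muFuel (rank b ∸ rank a) a b

  SemiEulerian : Set
  SemiEulerian = ∀ a b → T (le a b) → ¬ (a ≡ bot × b ≡ top) → mu a b ≡ sgn (rank b ∸ rank a)

  eQ : ℤ
  eQ = mu bot top - sgn (rank top)

  ĝ ĥ : Poly
  ĝ = gHat bot top
  ĥ = hHat bot top

  -- γ_k = (-1)^{r-k} C(r+1,k) e_Q ;  (-1)^{r-k} written as (-1)^{r+k} (same parity, avoids ℕ subtraction)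
  γ : ℕ → ℕ → ℤ
  γ r k = sgn (r ℕ.+ k) * (+ (suc r C k)) * eQ

  lhs58 : Poly
  lhs58 = ĝ ⊕ (xm1 ⊗ ĥ)

  -- x^{r+1} ĝ(Q,1/x): coefficient of x^k is ĝ_{r+1-k}  (ĝ has degree ≤ ⌊r/2⌋ < r+1,
  -- so no negative powers occur)
  reflG : ℕ → Poly
  reflG r k = if k ℕ.≤ᵇ suc r then ĝ (suc r ∸ k) else + 0

  gammaSum : ℕ → Poly
  gammaSum r k = if (suc (r ∸ ⌊ r /2⌋) ℕ.≤ᵇ k) ∧ (k ℕ.≤ᵇ suc r) then γ r k else + 0

  twoDelta : ℕ → Poly
  twoDelta r k = if (ℕ._%_ r 2 ℕ.≡ᵇ 1) ∧ (k ℕ.≡ᵇ (r ∸ ⌊ r /2⌋)) then γ r k else + 0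

  rhs58 : ℕ → Poly
  rhs58 r = reflG r ⊕ gammaSum r

-- Write G t = ĝ([0̂,t]) and H t = ĥ([0̂,t]); by definition Σ_{s ≤ t} G s (x-1)^{ρ(t)-ρ(s)} = G t + (x-1) H t.
-- Reflecting the defining sum of H b, where ρ(b) = d+1, and using the reflection identity
-- x^{ρ(t)} G t(1/x) = G t + (x-1) H t for t < b gives x^d H b(1/x) = Σ_{s<b} κ_s G s (x-1)^{d-ρ(s)}, where
-- κ_s = Σ_{s ≤ t < b} (-1)^{d-ρ(t)} = -(-1)^{d-ρ(s)} μ(s,b). On Eulerian intervals every κ_s is 1, so H b is
-- palindromic, and the construction of ĝ from ĥ turns this into the reflection identity for b.
-- In a semi-Eulerian Q only s = 0̂ contributes at 1̂, so x^r ĥ(1/x) = ĥ + c (x-1)^r with c = -(-1)^r e_Q(0̂,1̂).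
-- Comparing coefficients of ĝ + (x-1)ĥ and x^{r+1} ĝ(1/x) below ⌊r/2⌋, above it, and (for odd r) in the
-- middle degree then yields the formula with the coefficients of -c (x-1)^{r+1} in place of the γ_k.
-- These agree with the γ_k because, for even r, the constant and leading coefficients of x^r ĥ(1/x)
-- force c = 0.

module Submission where

open import Defs
open import Data.Bool using (Bool; true; false; T; _∧_; if_then_else_)
open import Data.Bool.Properties using (T-≡; T-∧; if-eta; if-float)
open import Data.Empty using (⊥-elim)
open import Data.Fin using (Fin; zero; suc)
open import Data.Fin.Properties using (suc-injective; _≟_; any?)
open import Data.Fin.Subset using (Subset; _∈_; _⊂_; ∣_∣)
open import Data.Fin.Subset.Properties using (p⊂q⇒∣p∣<∣q∣)
open import Data.Vec using (tabulate)
open import Data.Vec.Properties using (lookup∘tabulate; []=⇒lookup; lookup⇒[]=)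
open import Data.Integer using (ℤ; +_; -_; _+_; _-_; _*_)
import Data.Integer.Properties as ℤ
import Algebra.Properties.Semiring.Sum ℤ.+-*-semiring as Σ
open import Data.Integer.Tactic.RingSolver using (solve-∀)
open import Data.Nat as ℕ using (ℕ; zero; suc; _∸_; _≤_; _<_; z≤n; s≤s; _≤ᵇ_; _≡ᵇ_; ⌊_/2⌋; _%_)
import Data.Nat.Properties as ℕ
import Data.Nat.DivMod as DM
open import Data.Nat.Combinatorics using (_C_; nCk+nC[k+1]≡[n+1]C[k+1]; nCn≡1; k>n⇒nCk≡0)
open import Data.Product using (_×_; _,_; proj₁; proj₂)
open import Function using (_∘_; _$_; Equivalence; mk⇔)
open import Relation.Binary.PropositionalEquality
open import Relation.Binary using (tri<; tri≈; tri>)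
open import Relation.Nullary using (Dec; yes; no; ¬?; contradiction)
open import Relation.Nullary.Decidable using (does-⇔; dec-true; dec-false; isYes≗does; _×-dec_; T?; toWitnessFalse; fromWitnessFalse)

open Equivalence using (to; from)

if-then-cong : ∀ {A : Set} b {x y z : A} → (T b → x ≡ y) → (if b then x else z) ≡ (if b then y else z)
if-then-cong true  x≡y = x≡y _
if-then-cong false x≡y = refl

if-then-≡0 : ∀ β {x : ℤ} → (T β → x ≡ + 0) → (if β then x else + 0) ≡ + 0
if-then-≡0 true  x≡0 = x≡0 _
if-then-≡0 false x≡0 = refl

*-if : ∀ c β x → c * (if β then x else + 0) ≡ (if β then c * x else + 0)
*-if c true  x = refl
*-if c false x = ℤ.*-zeroʳ c

≤ᵇ-true : ∀ {m n} → m ≤ n → (m ≤ᵇ n) ≡ true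
≤ᵇ-true {m} {n} = dec-true (m ℕ.≤? n)

≤ᵇ-false : ∀ {m n} → n < m → (m ≤ᵇ n) ≡ false
≤ᵇ-false {m} {n} n<m = dec-false (m ℕ.≤? n) (ℕ.<⇒≱ n<m)

≡ᵇ-true : ∀ {m n} → m ≡ n → (m ≡ᵇ n) ≡ true
≡ᵇ-true {m} {n} = dec-true (m ℕ.≟ n)

≡ᵇ-false : ∀ {m n} → m ≢ n → (m ≡ᵇ n) ≡ false
≡ᵇ-false {m} {n} = dec-false (m ℕ.≟ n)

∸≡suc⇒≡+ : ∀ {m n d} → m ∸ n ≡ suc d → m ≡ n ℕ.+ suc d
∸≡suc⇒≡+ {m}     {zero}  eq = eq
∸≡suc⇒≡+ {suc m} {suc n} eq = cong suc (∸≡suc⇒≡+ eq)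

∸-split : ∀ {a b c} → a ≤ b → b ≤ c → c ∸ a ≡ (c ∸ b) ℕ.+ (b ∸ a)
∸-split {a} {b} {c} a≤b b≤c = trans (cong (_∸ a) (sym (ℕ.m∸n+n≡m b≤c))) (ℕ.+-∸-assoc (c ∸ b) a≤b)

n+n≡n*2 : ∀ n → n ℕ.+ n ≡ n ℕ.* 2
n+n≡n*2 n = trans (cong (n ℕ.+_) (sym (ℕ.+-identityʳ n))) (ℕ.*-comm 2 n)

even-∸-half : ∀ {n s} → n ≡ s ℕ.+ s → n ∸ s ≡ s
even-∸-half {s = s} refl = ℕ.m+n∸n≡m s s

odd-∸-half : ∀ {n s} → n ≡ suc (s ℕ.+ s) → n ∸ s ≡ suc s
odd-∸-half {s = s} refl = trans (ℕ.+-∸-assoc 1 (ℕ.m≤m+n s s)) (cong suc (ℕ.m+n∸m≡n s s))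

even-%2 : ∀ {n s} → n ≡ s ℕ.+ s → n % 2 ≡ 0
even-%2 {s = s} refl = trans (cong (_% 2) (n+n≡n*2 s)) (DM.m*n%n≡0 s 2)

odd-%2 : ∀ {n s} → n ≡ suc (s ℕ.+ s) → n % 2 ≡ 1
odd-%2 {s = s} refl = trans (cong (_% 2) (cong suc (n+n≡n*2 s))) (DM.[m+kn]%n≡m%n 1 s 2)

data Parity (n : ℕ) : Set where
  even : n ≡ ⌊ n /2⌋ ℕ.+ ⌊ n /2⌋ → Parity n
  odd  : n ≡ suc (⌊ n /2⌋ ℕ.+ ⌊ n /2⌋) → Parity n

parity : ∀ n → Parity n
parity zero          = even refl
parity (suc zero)    = odd refl
parity (suc (suc n)) with parity n
... | even n≡ = even (cong suc (trans (cong suc n≡) (sym (ℕ.+-suc ⌊ n /2⌋ ⌊ n /2⌋))))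
... | odd  n≡ = odd (cong (ℕ.suc ∘ ℕ.suc) (trans n≡ (sym (ℕ.+-suc ⌊ n /2⌋ ⌊ n /2⌋))))

sgn-+ : ∀ m n → sgn (m ℕ.+ n) ≡ sgn m * sgn n
sgn-+ zero    n = sym (ℤ.*-identityˡ (sgn n))
sgn-+ (suc m) n = trans (cong -_ (sgn-+ m n)) (ℤ.neg-distribˡ-* (sgn m) (sgn n))

sgn-square : ∀ m → sgn m * sgn m ≡ + 1
sgn-square zero    = refl
sgn-square (suc m) = trans (neg-square (sgn m)) (sgn-square m)
  where
  neg-square : ∀ a → (- a) * (- a) ≡ a * a
  neg-square = solve-∀

sgn-∸-shift : ∀ {a b c} → a ≤ b → b ≤ c → sgn (c ∸ b) ≡ sgn (c ∸ a) * sgn (b ∸ a)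
sgn-∸-shift {a} {b} {c} a≤b b≤c = begin
  sgn (c ∸ b)                                  ≡⟨ ℤ.*-identityʳ _ ⟨
  sgn (c ∸ b) * + 1                            ≡⟨ cong (sgn (c ∸ b) *_) (sgn-square (b ∸ a)) ⟨
  sgn (c ∸ b) * (sgn (b ∸ a) * sgn (b ∸ a))    ≡⟨ ℤ.*-assoc (sgn (c ∸ b)) _ _ ⟨
  sgn (c ∸ b) * sgn (b ∸ a) * sgn (b ∸ a)      ≡⟨ cong (_* sgn (b ∸ a)) (trans (sym (sgn-+ (c ∸ b) (b ∸ a))) (cong sgn (sym (∸-split a≤b b≤c)))) ⟩
  sgn (c ∸ a) * sgn (b ∸ a)                    ∎
  where open ≡-Reasoning

-- Finite sums

sumBelow-cong : ∀ n {f g : ℕ → ℤ} → (∀ i → i < n → f i ≡ g i) → sumBelow n f ≡ sumBelow n g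
sumBelow-cong zero    eq = refl
sumBelow-cong (suc n) eq = cong₂ _+_ (sumBelow-cong n (λ i i<n → eq i (ℕ.m<n⇒m<1+n i<n))) (eq n (ℕ.n<1+n n))

sumBelow-≡0 : ∀ n {f : ℕ → ℤ} → (∀ i → i < n → f i ≡ + 0) → sumBelow n f ≡ + 0
sumBelow-≡0 zero    eq = refl
sumBelow-≡0 (suc n) eq = cong₂ _+_ (sumBelow-≡0 n (λ i i<n → eq i (ℕ.m<n⇒m<1+n i<n))) (eq n (ℕ.n<1+n n))

sumBelow-distrib-- : ∀ n (f g : ℕ → ℤ) → sumBelow n (λ i → f i - g i) ≡ sumBelow n f - sumBelow n g
sumBelow-distrib-- zero    f g = refl
sumBelow-distrib-- (suc n) f g = trans (cong (_+ (f n - g n)) (sumBelow-distrib-- n f g)) (regroup (sumBelow n f) (sumBelow n g) (f n) (g n))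
  where
  regroup : ∀ a b c d → (a - b) + (c - d) ≡ (a + c) - (b + d)
  regroup = solve-∀

sumBelow-distrib-+ : ∀ n (f g : ℕ → ℤ) → sumBelow n (λ i → f i + g i) ≡ sumBelow n f + sumBelow n g
sumBelow-distrib-+ zero    f g = refl
sumBelow-distrib-+ (suc n) f g = trans (cong (_+ (f n + g n)) (sumBelow-distrib-+ n f g)) (regroup (sumBelow n f) (sumBelow n g) (f n) (g n))
  where
  regroup : ∀ a b c d → (a + b) + (c + d) ≡ (a + c) + (b + d)
  regroup = solve-∀

*-distribˡ-sumBelow : ∀ n c (f : ℕ → ℤ) → c * sumBelow n f ≡ sumBelow n (λ i → c * f i)
*-distribˡ-sumBelow zero    c f = ℤ.*-zeroʳ c
*-distribˡ-sumBelow (suc n) c f =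
  trans (ℤ.*-distribˡ-+ c (sumBelow n f) (f n)) (cong (_+ c * f n) (*-distribˡ-sumBelow n c f))

sumBelow-suc : ∀ n (f : ℕ → ℤ) → sumBelow (suc n) f ≡ f 0 + sumBelow n (f ∘ suc)
sumBelow-suc zero    f = ℤ.+-comm (+ 0) (f 0)
sumBelow-suc (suc n) f = trans (cong (_+ f (suc n)) (sumBelow-suc n f)) (ℤ.+-assoc (f 0) _ _)

sumBelow-reverse : ∀ n (f : ℕ → ℤ) → sumBelow n f ≡ sumBelow n (λ i → f (n ∸ suc i))
sumBelow-reverse zero    f = refl
sumBelow-reverse (suc n) f = begin
  sumBelow n f + f n                             ≡⟨ cong (_+ f n) (sumBelow-reverse n f) ⟩
  sumBelow n (λ i → f (n ∸ suc i)) + f n         ≡⟨ ℤ.+-comm _ (f n) ⟩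
  f n + sumBelow n (λ i → f (n ∸ suc i))         ≡⟨ sumBelow-suc n (λ i → f (n ∸ i)) ⟨
  sumBelow (suc n) (λ i → f (suc n ∸ suc i))     ∎
  where open ≡-Reasoning

sumFin≗sum : ∀ {n} (f : Fin n → ℤ) → sumFin f ≡ Σ.sum f
sumFin≗sum {zero}  f = refl
sumFin≗sum {suc n} f = cong (_+_ (f zero)) (sumFin≗sum (f ∘ suc))

sumFin-cong : ∀ {n} {f g : Fin n → ℤ} → (∀ t → f t ≡ g t) → sumFin f ≡ sumFin g
sumFin-cong {f = f} {g} eq = trans (sumFin≗sum f) (trans (Σ.sum-cong-≗ eq) (sym (sumFin≗sum g)))

sumFin-≡0 : ∀ {n} {f : Fin n → ℤ} → (∀ t → f t ≡ + 0) → sumFin f ≡ + 0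
sumFin-≡0 {zero}  eq = refl
sumFin-≡0 {suc n} eq = cong₂ _+_ (eq zero) (sumFin-≡0 (eq ∘ suc))

sumFin-distrib-+ : ∀ {n} (f g : Fin n → ℤ) → sumFin (λ t → f t + g t) ≡ sumFin f + sumFin g
sumFin-distrib-+ f g rewrite sumFin≗sum f | sumFin≗sum g | sumFin≗sum (λ t → f t + g t) = Σ.∑-distrib-+ f g

*-distribˡ-sumFin : ∀ {n} c (f : Fin n → ℤ) → c * sumFin f ≡ sumFin (λ t → c * f t)
*-distribˡ-sumFin c f rewrite sumFin≗sum f | sumFin≗sum (λ t → c * f t) = Σ.*-distribˡ-sum c f

*-distribʳ-sumFin : ∀ {n} c (f : Fin n → ℤ) → sumFin f * c ≡ sumFin (λ t → f t * c)
*-distribʳ-sumFin c f rewrite sumFin≗sum f | sumFin≗sum (λ t → f t * c) = Σ.*-distribʳ-sum c f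

sumFin-comm : ∀ {m n} (f : Fin m → Fin n → ℤ) →
              sumFin (λ t → sumFin (f t)) ≡ sumFin (λ s → sumFin (λ t → f t s))
sumFin-comm f = begin
  sumFin (λ t → sumFin (f t))              ≡⟨ trans (sumFin-cong (λ t → sumFin≗sum (f t))) (sumFin≗sum (λ t → Σ.sum (f t))) ⟩
  Σ.sum (λ t → Σ.sum (f t))                ≡⟨ Σ.∑-comm f ⟩
  Σ.sum (λ s → Σ.sum (λ t → f t s))        ≡⟨ trans (sumFin-cong (λ s → sumFin≗sum (λ t → f t s))) (sumFin≗sum (λ s → Σ.sum (λ t → f t s))) ⟨
  sumFin (λ s → sumFin (λ t → f t s))      ∎
  where open ≡-Reasoning

sumFin-sumBelow-comm : ∀ {m} n (f : Fin m → ℕ → ℤ) →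
                       sumFin (λ t → sumBelow n (f t)) ≡ sumBelow n (λ i → sumFin (λ t → f t i))
sumFin-sumBelow-comm zero    f = sumFin-≡0 {f = λ t → sumBelow zero (f t)} (λ _ → refl)
sumFin-sumBelow-comm (suc n) f =
  trans (sumFin-distrib-+ (λ t → sumBelow n (f t)) (λ t → f t n)) (cong (_+ sumFin (λ t → f t n)) (sumFin-sumBelow-comm n f))

sumFin-single : ∀ {n} (a : Fin n) (f : Fin n → ℤ) → (∀ t → t ≢ a → f t ≡ + 0) → sumFin f ≡ f a
sumFin-single zero f eq =
  trans (cong (_+_ (f zero)) (sumFin-≡0 (λ t → eq (suc t) λ ())) ) (ℤ.+-identityʳ _)
sumFin-single (suc a) f eq =
  trans (cong₂ _+_ (eq zero λ ()) (sumFin-single a (f ∘ suc) (λ t t≢a → eq (suc t) (t≢a ∘ suc-injective))))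
        (ℤ.+-identityˡ _)

-- Polynomials as coefficient functions

infix 4 _≈_
_≈_ : Poly → Poly → Set
p ≈ q = ∀ k → p k ≡ q k

scale : ℤ → Poly → Poly
scale c p k = c * p k

x· : Poly → Poly
x· p zero    = + 0
x· p (suc k) = p k

y^ : ℕ → Poly
y^ = ppow xm1

Deg≤ : ℕ → Poly → Set
Deg≤ n p = ∀ k → n < k → p k ≡ + 0

-- x^n p(1/x)
reflect : ℕ → Poly → Poly
reflect n p k = if k ≤ᵇ n then p (n ∸ k) else + 0

⊗-cong : ∀ {p p′ q q′} → p ≈ p′ → q ≈ q′ → p ⊗ q ≈ p′ ⊗ q′
⊗-cong p≈p′ q≈q′ k = sumBelow-cong (suc k) (λ i _ → cong₂ _*_ (p≈p′ i) (q≈q′ (k ∸ i)))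

⊗-congˡ : ∀ p {q q′} → q ≈ q′ → p ⊗ q ≈ p ⊗ q′
⊗-congˡ p = ⊗-cong {p} (λ _ → refl)

⊗-congʳ : ∀ {p p′} q → p ≈ p′ → p ⊗ q ≈ p′ ⊗ q
⊗-congʳ q p≈p′ = ⊗-cong {q = q} p≈p′ (λ _ → refl)

⊗-comm : ∀ p q → p ⊗ q ≈ q ⊗ p
⊗-comm p q k = trans (sumBelow-reverse (suc k) _) (sumBelow-cong (suc k) λ i i≤k →
  trans (cong (λ j → p (k ∸ i) * q j) (ℕ.m∸[m∸n]≡n (ℕ.≤-pred i≤k))) (ℤ.*-comm (p (k ∸ i)) (q i)))

⊗-identityʳ : ∀ p → p ⊗ pone ≈ p
⊗-identityʳ p k = begin
  sumBelow k (λ i → p i * pone (k ∸ i)) + p k * pone (k ∸ k) ≡⟨ cong₂ _+_ (sumBelow-≡0 k off-diagonal) (cong (λ j → p k * pone j) (ℕ.n∸n≡0 k)) ⟩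
  + 0 + p k * + 1                                              ≡⟨ trans (ℤ.+-identityˡ _) (ℤ.*-identityʳ (p k)) ⟩
  p k                                                          ∎
  where
  open ≡-Reasoning
  off-diagonal : ∀ i → i < k → p i * pone (k ∸ i) ≡ + 0
  off-diagonal i i<k with k ∸ i | ℕ.m>n⇒m∸n≢0 i<k
  ... | zero  | k∸i≢0 = ⊥-elim (k∸i≢0 refl)
  ... | suc _ | _     = ℤ.*-zeroʳ (p i)

⊗-identityˡ : ∀ p → pone ⊗ p ≈ p
⊗-identityˡ p k = trans (⊗-comm pone p k) (⊗-identityʳ p k)

⊗-distribˡ-- : ∀ p q r k → (p ⊗ (λ j → q j - r j)) k ≡ (p ⊗ q) k - (p ⊗ r) k
⊗-distribˡ-- p q r k = trans (sumBelow-cong (suc k) (λ i _ → distrib (p i) (q (k ∸ i)) (r (k ∸ i))))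
                             (sumBelow-distrib-- (suc k) _ _)
  where
  distrib : ∀ a b c → a * (b - c) ≡ a * b - a * c
  distrib = solve-∀

⊗-distribˡ-⊕ : ∀ p q r → p ⊗ (q ⊕ r) ≈ (p ⊗ q) ⊕ (p ⊗ r)
⊗-distribˡ-⊕ p q r k = trans (sumBelow-cong (suc k) (λ i _ → ℤ.*-distribˡ-+ (p i) _ _)) (sumBelow-distrib-+ (suc k) _ _)

⊗-scale : ∀ c p q → p ⊗ scale c q ≈ scale c (p ⊗ q)
⊗-scale c p q k = trans (sumBelow-cong (suc k) (λ i _ → swap (p i) c (q (k ∸ i)))) (sym (*-distribˡ-sumBelow (suc k) c _))
  where
  swap : ∀ a c b → a * (c * b) ≡ c * (a * b)
  swap = solve-∀

xm1⊗-coeff : ∀ p k → (xm1 ⊗ p) k ≡ x· p k - p k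
xm1⊗-coeff p zero    = lemma (p 0)
  where
  lemma : ∀ a → + 0 + - + 1 * a ≡ + 0 - a
  lemma = solve-∀
xm1⊗-coeff p (suc k) = begin
  sumBelow (suc (suc k)) (λ i → xm1 i * p (suc k ∸ i))
    ≡⟨ sumBelow-suc (suc k) _ ⟩
  - + 1 * p (suc k) + sumBelow (suc k) (λ i → xm1 (suc i) * p (k ∸ i))
    ≡⟨ cong (_+_ (- + 1 * p (suc k))) (sumBelow-suc k _) ⟩
  - + 1 * p (suc k) + (+ 1 * p k + sumBelow k (λ i → xm1 (suc (suc i)) * p (k ∸ suc i)))
    ≡⟨ cong (λ z → - + 1 * p (suc k) + (+ 1 * p k + z)) (sumBelow-≡0 k (λ _ _ → refl)) ⟩
  - + 1 * p (suc k) + (+ 1 * p k + + 0)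
    ≡⟨ lemma (p (suc k)) (p k) ⟩
  p k - p (suc k)
    ∎
  where
  open ≡-Reasoning
  lemma : ∀ a b → - + 1 * a + (+ 1 * b + + 0) ≡ b - a
  lemma = solve-∀

⊗-x· : ∀ p q → p ⊗ x· q ≈ x· (p ⊗ q)
⊗-x· p q zero    = trans (ℤ.+-identityˡ _) (ℤ.*-zeroʳ (p 0))
⊗-x· p q (suc k) = begin
  sumBelow (suc k) (λ i → p i * x· q (suc k ∸ i)) + p (suc k) * x· q (k ∸ k)
    ≡⟨ cong₂ _+_ (sumBelow-cong (suc k) (λ i i≤k → cong (λ j → p i * x· q j) (ℕ.+-∸-assoc 1 (ℕ.≤-pred i≤k))))
                 (cong (λ j → p (suc k) * x· q j) (ℕ.n∸n≡0 k)) ⟩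
  (p ⊗ q) k + p (suc k) * + 0
    ≡⟨ trans (cong (_+_ ((p ⊗ q) k)) (ℤ.*-zeroʳ (p (suc k)))) (ℤ.+-identityʳ _) ⟩
  (p ⊗ q) k
    ∎
  where open ≡-Reasoning

⊗-xm1⊗ : ∀ p q → p ⊗ (xm1 ⊗ q) ≈ xm1 ⊗ (p ⊗ q)
⊗-xm1⊗ p q k = begin
  (p ⊗ (xm1 ⊗ q)) k                  ≡⟨ ⊗-congˡ p (xm1⊗-coeff q) k ⟩
  (p ⊗ (λ j → x· q j - q j)) k    ≡⟨ ⊗-distribˡ-- p (x· q) q k ⟩
  (p ⊗ x· q) k - (p ⊗ q) k        ≡⟨ cong (_- (p ⊗ q) k) (⊗-x· p q k) ⟩
  x· (p ⊗ q) k - (p ⊗ q) k        ≡⟨ xm1⊗-coeff (p ⊗ q) k ⟨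
  (xm1 ⊗ (p ⊗ q)) k                  ∎
  where open ≡-Reasoning

⊗-y^-+ : ∀ p a m → (p ⊗ y^ a) ⊗ y^ m ≈ p ⊗ y^ (a ℕ.+ m)
⊗-y^-+ p a zero    k rewrite ℕ.+-identityʳ a = ⊗-identityʳ (p ⊗ y^ a) k
⊗-y^-+ p a (suc m) k rewrite ℕ.+-suc a m = begin
  ((p ⊗ y^ a) ⊗ (xm1 ⊗ y^ m)) k     ≡⟨ ⊗-xm1⊗ (p ⊗ y^ a) (y^ m) k ⟩
  (xm1 ⊗ ((p ⊗ y^ a) ⊗ y^ m)) k     ≡⟨ ⊗-congˡ xm1 (⊗-y^-+ p a m) k ⟩
  (xm1 ⊗ (p ⊗ y^ (a ℕ.+ m))) k      ≡⟨ ⊗-xm1⊗ p (y^ (a ℕ.+ m)) k ⟨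
  (p ⊗ (xm1 ⊗ y^ (a ℕ.+ m))) k      ∎
  where open ≡-Reasoning

psum-cong : ∀ {n} {f g : Fin n → Poly} → (∀ t → f t ≈ g t) → psum f ≈ psum g
psum-cong f≈g k = sumFin-cong (λ t → f≈g t k)

psum-⊗ : ∀ {n} (f : Fin n → Poly) q → psum f ⊗ q ≈ psum (λ t → f t ⊗ q)
psum-⊗ f q k = trans (sumBelow-cong (suc k) (λ i _ → *-distribʳ-sumFin (q (k ∸ i)) (λ t → f t i)))
                     (sym (sumFin-sumBelow-comm (suc k) (λ t i → f t i * q (k ∸ i))))

if-then-≈ : ∀ b {p q} → (T b → p ≈ q) → (if b then p else pzero) ≈ (if b then q else pzero)
if-then-≈ true  p≈q = p≈q _
if-then-≈ false p≈q k = refl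

if-⊗ : ∀ b p q → (if b then p else pzero) ⊗ q ≈ (if b then p ⊗ q else pzero)
if-⊗ true  p q k = refl
if-⊗ false p q k = sumBelow-≡0 (suc k) (λ _ _ → refl)

Deg≤-cong : ∀ {n p q} → p ≈ q → Deg≤ n p → Deg≤ n q
Deg≤-cong p≈q deg k n<k = trans (sym (p≈q k)) (deg k n<k)

Deg≤-⊗ : ∀ {a b p q} → Deg≤ a p → Deg≤ b q → Deg≤ (a ℕ.+ b) (p ⊗ q)
Deg≤-⊗ {a} {b} {p} {q} deg-p deg-q k a+b<k = sumBelow-≡0 (suc k) term
  where
  term : ∀ i → i < suc k → p i * q (k ∸ i) ≡ + 0
  term i _ with a ℕ.<? i
  ... | yes a<i = trans (cong (_* q (k ∸ i)) (deg-p i a<i)) (ℤ.*-zeroˡ (q (k ∸ i)))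
  ... | no  a≮i = trans (cong (p i *_) (deg-q (k ∸ i) b<k∸i)) (ℤ.*-zeroʳ (p i))
    where
    b<k∸i : b < k ∸ i
    b<k∸i = ℕ.<-≤-trans (subst (_< k ∸ a) (ℕ.m+n∸m≡n a b) (ℕ.∸-monoˡ-< a+b<k (ℕ.m≤m+n a b)))
                        (ℕ.∸-monoʳ-≤ k (ℕ.≮⇒≥ a≮i))

Deg≤-xm1 : Deg≤ 1 xm1
Deg≤-xm1 (suc zero)    (s≤s ())
Deg≤-xm1 (suc (suc k)) _ = refl

Deg≤-y^ : ∀ m → Deg≤ m (y^ m)
Deg≤-y^ zero    (suc k) _ = refl
Deg≤-y^ (suc m) = Deg≤-⊗ {1} {m} Deg≤-xm1 (Deg≤-y^ m)

Deg≤-psum : ∀ {m n} (f : Fin m → Poly) → (∀ t → Deg≤ n (f t)) → Deg≤ n (psum f)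
Deg≤-psum f deg k n<k = sumFin-≡0 (λ t → deg t k n<k)

Deg≤-if : ∀ {n} b p → (T b → Deg≤ n p) → Deg≤ n (if b then p else pzero)
Deg≤-if true  p deg = deg _
Deg≤-if false p deg k _ = refl

y^-coeff : ∀ n k → y^ n k ≡ sgn (n ℕ.+ k) * + (n C k)
y^-coeff zero    zero    = refl
y^-coeff zero    (suc k) = sym (trans (cong (λ c → sgn (suc k) * + c) (k>n⇒nCk≡0 {0} {suc k} (s≤s z≤n))) (ℤ.*-zeroʳ (sgn (suc k))))
y^-coeff (suc n) k = begin
  (xm1 ⊗ y^ n) k                 ≡⟨ xm1⊗-coeff (y^ n) k ⟩
  x· (y^ n) k - y^ n k        ≡⟨ pascal k ⟩
  sgn (suc n ℕ.+ k) * + (suc n C k) ∎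
  where
  open ≡-Reasoning
  pascal : ∀ k → x· (y^ n) k - y^ n k ≡ sgn (suc n ℕ.+ k) * + (suc n C k)
  pascal zero    rewrite y^-coeff n 0 = lemma (sgn (n ℕ.+ 0))
    where
    lemma : ∀ s → + 0 - s * + 1 ≡ - s * + 1
    lemma = solve-∀
  pascal (suc k) rewrite y^-coeff n k | y^-coeff n (suc k) | ℕ.+-suc n k
                       | sym (nCk+nC[k+1]≡[n+1]C[k+1] n k) | ℤ.pos-+ (n C k) (n C suc k) =
    lemma (sgn (n ℕ.+ k)) (+ (n C k)) (+ (n C suc k))
    where
    lemma : ∀ s a b → s * a - (- s) * b ≡ (- - s) * (a + b)
    lemma = solve-∀

reflect-≤ : ∀ {n k} p → k ≤ n → reflect n p k ≡ p (n ∸ k)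
reflect-≤ p k≤n rewrite ≤ᵇ-true k≤n = refl

reflect-> : ∀ {n k} p → n < k → reflect n p k ≡ + 0
reflect-> p n<k rewrite ≤ᵇ-false n<k = refl

reflect-cong : ∀ n {p q} → p ≈ q → reflect n p ≈ reflect n q
reflect-cong n {p} {q} p≈q k with k ℕ.≤? n
... | yes k≤n = trans (reflect-≤ p k≤n) (trans (p≈q (n ∸ k)) (sym (reflect-≤ q k≤n)))
... | no  k≰n = trans (reflect-> p (ℕ.≰⇒> k≰n)) (sym (reflect-> q (ℕ.≰⇒> k≰n)))

reflect-- : ∀ n p q k → reflect n (λ j → p j - q j) k ≡ reflect n p k - reflect n q k
reflect-- n p q k with k ℕ.≤? n
... | yes k≤n rewrite reflect-≤ p k≤n | reflect-≤ q k≤n = reflect-≤ (λ j → p j - q j) k≤n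
... | no  k≰n rewrite reflect-> p (ℕ.≰⇒> k≰n) | reflect-> q (ℕ.≰⇒> k≰n) = reflect-> (λ j → p j - q j) (ℕ.≰⇒> k≰n)

reflect-x· : ∀ n p → reflect (suc n) (x· p) ≈ reflect n p
reflect-x· n p k with k ℕ.≤? n
... | yes k≤n = trans (reflect-≤ (x· p) (ℕ.m≤n⇒m≤1+n k≤n))
                      (trans (cong (x· p) (ℕ.+-∸-assoc 1 k≤n)) (sym (reflect-≤ p k≤n)))
... | no  k≰n = trans top-vanishes (sym (reflect-> p (ℕ.≰⇒> k≰n)))
  where
  top-vanishes : reflect (suc n) (x· p) k ≡ + 0
  top-vanishes with k ≤ᵇ suc n
  ... | true  rewrite ℕ.m≤n⇒m∸n≡0 (ℕ.≰⇒> k≰n) = refl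
  ... | false = refl

reflect-suc : ∀ n {p} → Deg≤ n p → reflect (suc n) p ≈ x· (reflect n p)
reflect-suc n     deg zero = deg (suc n) (ℕ.n<1+n n)
reflect-suc n {p} deg (suc k) with k ℕ.≤? n
... | yes k≤n = trans (reflect-≤ p (s≤s k≤n)) (sym (reflect-≤ p k≤n))
... | no  k≰n = trans (reflect-> p (s≤s (ℕ.≰⇒> k≰n))) (sym (reflect-> p (ℕ.≰⇒> k≰n)))

reflect-xm1⊗ : ∀ n {p} → Deg≤ n p → reflect (suc n) (xm1 ⊗ p) ≈ scale (- + 1) (xm1 ⊗ reflect n p)
reflect-xm1⊗ n {p} deg k = begin
  reflect (suc n) (xm1 ⊗ p) k                                  ≡⟨ reflect-cong (suc n) (xm1⊗-coeff p) k ⟩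
  reflect (suc n) (λ j → x· p j - p j) k                    ≡⟨ reflect-- (suc n) (x· p) p k ⟩
  reflect (suc n) (x· p) k - reflect (suc n) p k            ≡⟨ cong₂ _-_ (reflect-x· n p k) (reflect-suc n deg k) ⟩
  reflect n p k - x· (reflect n p) k                        ≡⟨ lemma (reflect n p k) (x· (reflect n p) k) ⟩
  - + 1 * (x· (reflect n p) k - reflect n p k)              ≡⟨ cong (- + 1 *_) (xm1⊗-coeff (reflect n p) k) ⟨
  - + 1 * (xm1 ⊗ reflect n p) k                                ∎
  where
  open ≡-Reasoning
  lemma : ∀ a b → a - b ≡ - + 1 * (b - a)
  lemma = solve-∀

reflect-⊗-y^ : ∀ a m {p} → Deg≤ a p → reflect (a ℕ.+ m) (p ⊗ y^ m) ≈ scale (sgn m) (reflect a p ⊗ y^ m)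
reflect-⊗-y^ a zero    {p} deg k rewrite ℕ.+-identityʳ a =
  trans (reflect-cong a (⊗-identityʳ p) k) (sym (trans (ℤ.*-identityˡ _) (⊗-identityʳ (reflect a p) k)))
reflect-⊗-y^ a (suc m) {p} deg k rewrite ℕ.+-suc a m = begin
  reflect (suc (a ℕ.+ m)) (p ⊗ (xm1 ⊗ y^ m)) k          ≡⟨ reflect-cong (suc (a ℕ.+ m)) (⊗-xm1⊗ p (y^ m)) k ⟩
  reflect (suc (a ℕ.+ m)) (xm1 ⊗ (p ⊗ y^ m)) k          ≡⟨ reflect-xm1⊗ (a ℕ.+ m) (Deg≤-⊗ deg (Deg≤-y^ m)) k ⟩
  - + 1 * (xm1 ⊗ reflect (a ℕ.+ m) (p ⊗ y^ m)) k        ≡⟨ cong (- + 1 *_) (⊗-congˡ xm1 (reflect-⊗-y^ a m deg) k) ⟩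
  - + 1 * (xm1 ⊗ scale (sgn m) (reflect a p ⊗ y^ m)) k  ≡⟨ cong (- + 1 *_) (⊗-scale (sgn m) xm1 (reflect a p ⊗ y^ m) k) ⟩
  - + 1 * (sgn m * (xm1 ⊗ (reflect a p ⊗ y^ m)) k)      ≡⟨ cong (λ z → - + 1 * (sgn m * z)) (⊗-xm1⊗ (reflect a p) (y^ m) k) ⟨
  - + 1 * (sgn m * (reflect a p ⊗ y^ (suc m)) k)        ≡⟨ lemma (sgn m) ((reflect a p ⊗ y^ (suc m)) k) ⟩
  sgn (suc m) * (reflect a p ⊗ y^ (suc m)) k            ∎
  where
  open ≡-Reasoning
  lemma : ∀ s z → - + 1 * (s * z) ≡ - s * z
  lemma = solve-∀

reflect-zero : ∀ {p} → Deg≤ 0 p → reflect 0 p ≈ p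
reflect-zero     deg zero    = refl
reflect-zero {p} deg (suc k) = trans (reflect-> {0} {suc k} p (s≤s z≤n)) (sym (deg (suc k) (s≤s z≤n)))

reflect-psum : ∀ n {m} (f : Fin m → Poly) → reflect n (psum f) ≈ psum (λ t → reflect n (f t))
reflect-psum n f k with k ℕ.≤? n
... | yes k≤n = trans (reflect-≤ (psum f) k≤n) (sumFin-cong (λ t → sym (reflect-≤ (f t) k≤n)))
... | no  k≰n = trans (reflect-> (psum f) (ℕ.≰⇒> k≰n)) (sym (sumFin-≡0 (λ t → reflect-> (f t) (ℕ.≰⇒> k≰n))))

reflect-if : ∀ n b p → reflect n (if b then p else pzero) ≈ (if b then reflect n p else pzero)
reflect-if n true  p k = refl
reflect-if n false p k with k ≤ᵇ n
... | true  = refl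
... | false = refl

-- ĝ from an almost palindromic ĥ

gFromH-cong : ∀ d {h h′} → h ≈ h′ → gFromH d h ≈ gFromH d h′
gFromH-cong d h≈h′ zero    = h≈h′ (d ∸ d)
gFromH-cong d h≈h′ (suc k) = cong (if suc k ≤ᵇ ⌊ d /2⌋ then_else + 0) (cong₂ _-_ (h≈h′ _) (h≈h′ _))

gFromH-low : ∀ d h k → k ≤ ⌊ d /2⌋ → gFromH d h k ≡ - (xm1 ⊗ h) k
gFromH-low d h zero    _ = begin
  h (d ∸ d)            ≡⟨ cong h (ℕ.n∸n≡0 d) ⟩
  h 0                  ≡⟨ lemma (h 0) ⟩
  - (+ 0 - h 0)        ≡⟨ cong -_ (xm1⊗-coeff h 0) ⟨
  - (xm1 ⊗ h) 0        ∎
  where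
  open ≡-Reasoning
  lemma : ∀ a → a ≡ - (+ 0 - a)
  lemma = solve-∀
gFromH-low d h (suc k) k<⌊d/2⌋ rewrite ≤ᵇ-true k<⌊d/2⌋ = begin
  h (d ∸ (d ∸ suc k)) - h (d ∸ suc (d ∸ suc k))   ≡⟨ cong₂ _-_ (cong h (ℕ.m∸[m∸n]≡n k<d)) (cong h mirror) ⟩
  h (suc k) - h k                                  ≡⟨ lemma (h (suc k)) (h k) ⟩
  - (h k - h (suc k))                              ≡⟨ cong -_ (xm1⊗-coeff h (suc k)) ⟨
  - (xm1 ⊗ h) (suc k)                              ∎
  where
  open ≡-Reasoning
  k<d : suc k ≤ d
  k<d = ℕ.≤-trans k<⌊d/2⌋ (ℕ.⌊n/2⌋≤n d)
  mirror : d ∸ suc (d ∸ suc k) ≡ k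
  mirror = trans (cong (d ∸_) (sym (ℕ.+-∸-assoc 1 k<d))) (ℕ.m∸[m∸n]≡n (ℕ.<⇒≤ k<d))
  lemma : ∀ a b → a - b ≡ - (b - a)
  lemma = solve-∀

gFromH-high : ∀ d h k → ⌊ d /2⌋ < k → gFromH d h k ≡ + 0
gFromH-high d h (suc k) ⌊d/2⌋<k rewrite ≤ᵇ-false ⌊d/2⌋<k = refl

module AlmostPalindromic (d : ℕ) (h : Poly) (c : ℤ) (deg-h : Deg≤ d h)
                         (h-reflect : reflect d h ≈ h ⊕ scale c (y^ d)) where

  s : ℕ
  s = ⌊ d /2⌋

  g b : Poly
  g = gFromH d h
  b = xm1 ⊗ h

  Deg≤-b : Deg≤ (suc d) b
  Deg≤-b = Deg≤-⊗ {1} {d} Deg≤-xm1 deg-h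

  b-reflect : ∀ j → j ≤ suc d → b (suc d ∸ j) ≡ - (b j + c * y^ (suc d) j)
  b-reflect j j≤ = begin
    b (suc d ∸ j)                               ≡⟨ reflect-≤ b j≤ ⟨
    reflect (suc d) b j                         ≡⟨ reflect-xm1⊗ d deg-h j ⟩
    - + 1 * (xm1 ⊗ reflect d h) j               ≡⟨ ℤ.-1*i≡-i _ ⟩
    - (xm1 ⊗ reflect d h) j                     ≡⟨ cong -_ (⊗-congˡ xm1 h-reflect j) ⟩
    - (xm1 ⊗ (h ⊕ scale c (y^ d))) j            ≡⟨ cong -_ (⊗-distribˡ-⊕ xm1 h (scale c (y^ d)) j) ⟩
    - (b j + (xm1 ⊗ scale c (y^ d)) j)          ≡⟨ cong (λ z → - (b j + z)) (⊗-scale c xm1 (y^ d) j) ⟩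
    - (b j + c * y^ (suc d) j)                  ∎
    where open ≡-Reasoning

  -- compare the coefficients of x⁰ and xᵈ in reflect d h ≈ h ⊕ scale c (y^ d)
  defect-even : c * (sgn d + + 1) ≡ + 0
  defect-even = begin
    c * (sgn d + + 1)                ≡⟨ regroup (h 0) c (sgn d) ⟩
    h 0 + c * sgn d + c - h 0        ≡⟨ cong (λ z → z + c - h 0) top ⟨
    h d + c - h 0                    ≡⟨ cong (_- h 0) bottom ⟨
    h 0 - h 0                        ≡⟨ ℤ.+-inverseʳ (h 0) ⟩
    + 0                              ∎
    where
    open ≡-Reasoning
    regroup : ∀ h₀ c σ → c * (σ + + 1) ≡ h₀ + c * σ + c - h₀
    regroup = solve-∀
    top : h d ≡ h 0 + c * sgn d
    top = trans (h-reflect 0) (cong (λ z → h 0 + c * z) constant)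
      where
      constant : y^ d 0 ≡ sgn d
      constant = trans (y^-coeff d 0) (trans (cong (λ n → sgn n * + 1) (ℕ.+-identityʳ d)) (ℤ.*-identityʳ _))
    bottom : h 0 ≡ h d + c
    bottom = begin
      h 0                  ≡⟨ cong h (ℕ.n∸n≡0 d) ⟨
      h (d ∸ d)            ≡⟨ reflect-≤ {d} h ℕ.≤-refl ⟨
      reflect d h d        ≡⟨ h-reflect d ⟩
      h d + c * y^ d d     ≡⟨ cong (λ z → h d + c * z) leading ⟩
      h d + c * + 1        ≡⟨ cong (_+_ (h d)) (ℤ.*-identityʳ c) ⟩
      h d + c              ∎
      where
      open ≡-Reasoning
      leading : y^ d d ≡ + 1
      leading = trans (y^-coeff d d) (trans (cong₂ (λ σ n → σ * + n) (sgn-+ d d) (nCn≡1 d))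
                      (trans (ℤ.*-identityʳ _) (sgn-square d)))

  s+s≤d : s ℕ.+ s ≤ d
  s+s≤d = ℕ.≤-trans (ℕ.+-monoʳ-≤ s (ℕ.⌊n/2⌋≤⌈n/2⌉ d)) (ℕ.≤-reflexive (ℕ.⌊n/2⌋+⌈n/2⌉≡n d))

  low-vanishes : ∀ {k} → k ≤ s → (g ⊕ b) k ≡ + 0 × reflect (suc d) g k ≡ + 0
  low-vanishes {k} k≤s =
      trans (cong (_+ b k) (gFromH-low d h k k≤s)) (ℤ.+-inverseˡ (b k))
    , trans (reflect-≤ g k≤1+d) (gFromH-high d h (suc d ∸ k) s<1+d∸k)
    where
    k≤1+d : k ≤ suc d
    k≤1+d = ℕ.≤-trans k≤s (ℕ.≤-trans (ℕ.⌊n/2⌋≤n d) (ℕ.n≤1+n d))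
    s<1+d∸k : s < suc d ∸ k
    s<1+d∸k = ℕ.m+n≤o⇒m≤o∸n (suc s) (s≤s (ℕ.≤-trans (ℕ.+-monoʳ-≤ s k≤s) s+s≤d))

  beyond-vanishes : ∀ {k} → suc d < k → (g ⊕ b) k ≡ + 0 × reflect (suc d) g k ≡ + 0
  beyond-vanishes {k} 1+d<k =
      cong₂ _+_ (gFromH-high d h k s<k) (Deg≤-b k 1+d<k)
    , reflect-> g 1+d<k
    where
    s<k : s < k
    s<k = ℕ.<-trans (s≤s (ℕ.⌊n/2⌋≤n d)) 1+d<k

  high-reflects : ∀ {k} → s < k → k ≤ suc d → suc d ∸ k ≤ s →
                  (g ⊕ b) k ≡ reflect (suc d) g k + - c * y^ (suc d) k
  high-reflects {k} s<k k≤1+d 1+d∸k≤s = begin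
    g k + b k                                    ≡⟨ cong (_+ b k) (gFromH-high d h k s<k) ⟩
    + 0 + b k                                    ≡⟨ lemma (b k) c (y^ (suc d) k) ⟩
    - - (b k + c * y^ (suc d) k) + - c * y^ (suc d) k
                                                 ≡⟨ cong (λ z → - z + - c * y^ (suc d) k) (b-reflect k k≤1+d) ⟨
    - b (suc d ∸ k) + - c * y^ (suc d) k         ≡⟨ cong (_+ - c * y^ (suc d) k) (gFromH-low d h (suc d ∸ k) 1+d∸k≤s) ⟨
    g (suc d ∸ k) + - c * y^ (suc d) k           ≡⟨ cong (_+ - c * y^ (suc d) k) (reflect-≤ g k≤1+d) ⟨
    reflect (suc d) g k + - c * y^ (suc d) k     ∎
    where
    open ≡-Reasoning
    lemma : ∀ b c y → + 0 + b ≡ - - (b + c * y) + - c * y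
    lemma = solve-∀

  middle-reflects : ∀ {k} → s < k → k ≤ suc d → suc d ∸ k ≡ k →
                    + 2 * (g ⊕ b) k ≡ - c * y^ (suc d) k × reflect (suc d) g k ≡ + 0
  middle-reflects {k} s<k k≤1+d 1+d∸k≡k =
      (begin
        + 2 * (g k + b k)                        ≡⟨ cong (λ z → + 2 * (z + b k)) (gFromH-high d h k s<k) ⟩
        + 2 * (+ 0 + b k)                        ≡⟨ double (b k) ⟩
        b k + b k                                ≡⟨ cong (λ j → b k + b j) 1+d∸k≡k ⟨
        b k + b (suc d ∸ k)                      ≡⟨ cong (_+_ (b k)) (b-reflect k k≤1+d) ⟩
        b k + - (b k + c * y^ (suc d) k)         ≡⟨ cancel (b k) c (y^ (suc d) k) ⟩
        - c * y^ (suc d) k                       ∎)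
    , trans (reflect-≤ g k≤1+d) (trans (cong g 1+d∸k≡k) (gFromH-high d h k s<k))
    where
    open ≡-Reasoning
    double : ∀ a → + 2 * (+ 0 + a) ≡ a + a
    double = solve-∀
    cancel : ∀ a c y → a + - (a + c * y) ≡ - c * y
    cancel = solve-∀

  module _ (X : Poly) (X≡ : ∀ k → X k ≡ - c * y^ (suc d) k) where

    private
      vanishing : ∀ {k} → (g ⊕ b) k ≡ + 0 × reflect (suc d) g k ≡ + 0 →
                  + 2 * (g ⊕ b) k ≡ + 2 * (reflect (suc d) g k + + 0) + + 0
      vanishing (lhs≡0 , rhs≡0) rewrite lhs≡0 | rhs≡0 = refl

      high : ∀ {k} → s < k → k ≤ suc d → suc d ∸ k ≤ s →
             + 2 * (g ⊕ b) k ≡ + 2 * (reflect (suc d) g k + (if k ≤ᵇ suc d then X k else + 0)) + + 0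
      high {k} s<k k≤1+d 1+d∸k≤s rewrite X≡ k | high-reflects s<k k≤1+d 1+d∸k≤s =
        trans (sym (ℤ.+-identityʳ _))
              (cong (λ z → + 2 * (reflect (suc d) g k + z) + + 0) (cong (if_then - c * y^ (suc d) k else + 0) (sym (≤ᵇ-true k≤1+d))))

      beyond : ∀ {k} → suc d < k →
               + 2 * (g ⊕ b) k ≡ + 2 * (reflect (suc d) g k + (if k ≤ᵇ suc d then X k else + 0)) + + 0
      beyond {k} 1+d<k = trans (vanishing {k} (beyond-vanishes 1+d<k))
                               (cong (λ z → + 2 * (reflect (suc d) g k + z) + + 0) (cong (if_then X k else + 0) (sym (≤ᵇ-false 1+d<k))))

      middle : d ≡ suc (s ℕ.+ s) →
               + 2 * (g ⊕ b) (suc s)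
               ≡ + 2 * (reflect (suc d) g (suc s) + (if (suc (suc s) ≤ᵇ suc s) ∧ (suc s ≤ᵇ suc d) then X (suc s) else + 0))
                 + X (suc s)
      middle d≡ = begin
        + 2 * (g ⊕ b) (suc s)                                ≡⟨ proj₁ at-middle ⟩
        - c * y^ (suc d) (suc s)                             ≡⟨ X≡ (suc s) ⟨
        X (suc s)                                            ≡⟨ ℤ.+-identityˡ (X (suc s)) ⟨
        + 2 * (+ 0 + + 0) + X (suc s)                        ≡⟨ cong (λ z → + 2 * (z + + 0) + X (suc s)) (proj₂ at-middle) ⟨
        + 2 * (reflect (suc d) g (suc s) + + 0) + X (suc s)
          ≡⟨ cong (λ β → + 2 * (reflect (suc d) g (suc s) + (if β ∧ (suc s ≤ᵇ suc d) then X (suc s) else + 0)) + X (suc s))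
                  (≤ᵇ-false (ℕ.n<1+n (suc s))) ⟨
        + 2 * (reflect (suc d) g (suc s) + (if (suc (suc s) ≤ᵇ suc s) ∧ (suc s ≤ᵇ suc d) then X (suc s) else + 0)) + X (suc s) ∎
        where
        open ≡-Reasoning
        1+s≤1+d : suc s ≤ suc d
        1+s≤1+d = s≤s (subst (s ≤_) (sym d≡) (ℕ.≤-trans (ℕ.m≤m+n s s) (ℕ.n≤1+n _)))
        at-middle : + 2 * (g ⊕ b) (suc s) ≡ - c * y^ (suc d) (suc s) × reflect (suc d) g (suc s) ≡ + 0
        at-middle = middle-reflects (ℕ.n<1+n s) 1+s≤1+d (odd-∸-half d≡)

    reflection-even : d ≡ s ℕ.+ s → ∀ k →
      + 2 * (g ⊕ b) k ≡ + 2 * (reflect (suc d) g k + (if (suc s ≤ᵇ k) ∧ (k ≤ᵇ suc d) then X k else + 0)) + + 0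
    reflection-even d≡ k with k ℕ.≤? s
    ... | yes k≤s rewrite ≤ᵇ-false {suc s} (s≤s k≤s) = vanishing {k} (low-vanishes k≤s)
    ... | no  k≰s with k ℕ.≤? suc d
    ...   | yes k≤1+d rewrite ≤ᵇ-true (ℕ.≰⇒> k≰s) =
      high (ℕ.≰⇒> k≰s) k≤1+d (ℕ.m≤n+o⇒m∸n≤o (suc d) k (subst (_≤ k ℕ.+ s) (cong suc (sym d≡)) (ℕ.+-monoˡ-≤ s (ℕ.≰⇒> k≰s))))
    ...   | no  k≰1+d rewrite ≤ᵇ-true (ℕ.≰⇒> k≰s) = beyond (ℕ.≰⇒> k≰1+d)

    reflection-odd : d ≡ suc (s ℕ.+ s) → ∀ k →
      + 2 * (g ⊕ b) k ≡ + 2 * (reflect (suc d) g k + (if (suc (suc s) ≤ᵇ k) ∧ (k ≤ᵇ suc d) then X k else + 0))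
                        + (if k ≡ᵇ suc s then X k else + 0)
    reflection-odd d≡ k with ℕ.<-cmp k (suc s)
    ... | tri< k<1+s _ _ rewrite ≤ᵇ-false {suc (suc s)} (ℕ.m<n⇒m<1+n k<1+s) | ≡ᵇ-false (ℕ.<⇒≢ k<1+s) =
      vanishing {k} (low-vanishes (ℕ.≤-pred k<1+s))
    ... | tri≈ _ refl _ rewrite ≡ᵇ-true {suc s} refl = middle d≡
    ... | tri> _ k≢1+s 1+s<k with k ℕ.≤? suc d
    ...   | yes k≤1+d rewrite ≤ᵇ-true 1+s<k | ≡ᵇ-false k≢1+s =
      high (ℕ.<-trans (ℕ.n<1+n s) 1+s<k) k≤1+d
           (ℕ.m≤n+o⇒m∸n≤o (suc d) k (subst (_≤ k ℕ.+ s) (cong suc (sym d≡)) (ℕ.+-monoˡ-≤ s 1+s<k)))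
    ...   | no  k≰1+d rewrite ≤ᵇ-true 1+s<k | ≡ᵇ-false k≢1+s = beyond (ℕ.≰⇒> k≰1+d)

    reflection : ∀ k →
      + 2 * (g ⊕ b) k ≡ + 2 * (reflect (suc d) g k + (if (suc (d ∸ s) ≤ᵇ k) ∧ (k ≤ᵇ suc d) then X k else + 0))
                        + (if (d % 2 ≡ᵇ 1) ∧ (k ≡ᵇ (d ∸ s)) then X k else + 0)
    reflection k with parity d
    ... | even d≡ rewrite even-∸-half {s = s} d≡ | even-%2 {s = s} d≡ = reflection-even d≡ k
    ... | odd  d≡ rewrite odd-∸-half {s = s} d≡ | odd-%2 {s = s} d≡ = reflection-odd d≡ k

palindromic-reflection : ∀ d {h} → Deg≤ d h → reflect d h ≈ h → gFromH d h ⊕ (xm1 ⊗ h) ≈ reflect (suc d) (gFromH d h)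
palindromic-reflection d {h} deg-h h-reflect k = ℤ.*-cancelˡ-≡ (+ 2) _ _ (begin
  + 2 * (g ⊕ b) k                            ≡⟨ reflection (λ _ → + 0) (λ j → sym (ℤ.*-zeroˡ (y^ (suc d) j))) k ⟩
  + 2 * (reflect (suc d) g k + (if _ then + 0 else + 0)) + (if _ then + 0 else + 0)
                                             ≡⟨ cong₂ (λ γ δ → + 2 * (reflect (suc d) g k + γ) + δ) (if-eta _) (if-eta _) ⟩
  + 2 * (reflect (suc d) g k + + 0) + + 0    ≡⟨ ℤ.+-identityʳ _ ⟩
  + 2 * (reflect (suc d) g k + + 0)          ≡⟨ cong (+ 2 *_) (ℤ.+-identityʳ _) ⟩
  + 2 * reflect (suc d) g k                  ∎)
  where
  open ≡-Reasoning
  open AlmostPalindromic d h (+ 0) deg-h (λ j → trans (h-reflect j) (sym (trans (cong (_+_ (h j)) (ℤ.*-zeroˡ (y^ d j))) (ℤ.+-identityʳ (h j)))))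

-- Graded posets

module Graded (Q : GradedPoset) where
  open GradedPoset Q

  infix 4 _≤Q_ _<Q_
  _≤Q_ _<Q_ : Fin card → Fin card → Set
  a ≤Q b = T (le a b)
  _<Q_ = Lt le

  _<Q?_ : ∀ a b → Dec (a <Q b)
  a <Q? b = T? (le a b) ×-dec ¬? (a ≟ b)

  inHalfOpen⁻ : ∀ {a t b} → T (inHalfOpen Q a t b) → a ≤Q t × t <Q b
  inHalfOpen⁻ {a} {t} {b} x with to T-∧ x
  ... | a≤t , y with to T-∧ y
  ...   | t≤b , t≢b = a≤t , t≤b , toWitnessFalse t≢b

  inHalfOpen⁺ : ∀ {a t b} → a ≤Q t → t <Q b → T (inHalfOpen Q a t b)
  inHalfOpen⁺ a≤t (t≤b , t≢b) = from T-∧ (a≤t , from T-∧ (t≤b , fromWitnessFalse t≢b))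

  ==-refl : ∀ a → _==_ Q a a ≡ true
  ==-refl a = trans (isYes≗does (a ≟ a)) (dec-true (a ≟ a) refl)

  ==-≢ : ∀ {a b} → a ≢ b → _==_ Q a b ≡ false
  ==-≢ {a} {b} a≢b = trans (isYes≗does (a ≟ b)) (dec-false (a ≟ b) a≢b)

  interval : Fin card → Fin card → Subset card
  interval a b = tabulate (λ x → le a x ∧ le x b)

  ∈-interval⁺ : ∀ {a b x} → a ≤Q x → x ≤Q b → x ∈ interval a b
  ∈-interval⁺ {x = x} a≤x x≤b = lookup⇒[]= x _ (trans (lookup∘tabulate _ x) (to T-≡ (from T-∧ (a≤x , x≤b))))

  ∈-interval⁻ : ∀ {a b x} → x ∈ interval a b → a ≤Q x × x ≤Q b
  ∈-interval⁻ {x = x} x∈ = to T-∧ (from T-≡ (trans (sym (lookup∘tabulate _ x)) ([]=⇒lookup x∈)))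

  interval-⊂ˡ : ∀ {a b c} → a <Q c → c <Q b → interval a c ⊂ interval a b
  interval-⊂ˡ {a} {b} {c} (a≤c , _) (c≤b , c≢b) =
      (λ x∈ → let a≤x , x≤c = ∈-interval⁻ x∈ in ∈-interval⁺ a≤x (le-trans _ c b x≤c c≤b))
    , b , ∈-interval⁺ (le-trans a c b a≤c c≤b) (le-refl b)
    , λ b∈ → c≢b (le-antisym c b c≤b (proj₂ (∈-interval⁻ b∈)))

  interval-⊂ʳ : ∀ {a b c} → a <Q c → c <Q b → interval c b ⊂ interval a b
  interval-⊂ʳ {a} {b} {c} (a≤c , a≢c) (c≤b , _) =
      (λ x∈ → let c≤x , x≤b = ∈-interval⁻ x∈ in ∈-interval⁺ (le-trans a c _ a≤c c≤x) x≤b)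
    , a , ∈-interval⁺ (le-refl a) (le-trans a c b a≤c c≤b)
    , λ a∈ → a≢c (le-antisym a c a≤c (proj₁ (∈-interval⁻ a∈)))

  -- induction on the size of [a,b]: either b covers a, or some c strictly between splits it
  rank-<-bounded : ∀ n {a b} → ∣ interval a b ∣ ≤ n → a <Q b → rank a < rank b
  rank-<-bounded n {a} {b} size≤n a<b with any? (λ c → (a <Q? c) ×-dec (c <Q? b))
  ... | no  ∄c = ℕ.≤-reflexive (sym (rank-cover a b (a<b , λ c a<c c<b → ∄c (c , a<c , c<b))))
  ... | yes (c , a<c , c<b) = split n size≤n
    where
    split : ∀ n → ∣ interval a b ∣ ≤ n → rank a < rank b
    split zero    size≤0 = contradiction (ℕ.<-≤-trans (p⊂q⇒∣p∣<∣q∣ (interval-⊂ˡ a<c c<b)) size≤0) ℕ.n≮0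
    split (suc n) size≤n = ℕ.<-trans (rank-<-bounded n (shrink (interval-⊂ˡ a<c c<b)) a<c)
                                     (rank-<-bounded n (shrink (interval-⊂ʳ a<c c<b)) c<b)
      where
      shrink : ∀ {p} → p ⊂ interval a b → ∣ p ∣ ≤ n
      shrink p⊂ = ℕ.≤-pred (ℕ.<-≤-trans (p⊂q⇒∣p∣<∣q∣ p⊂) size≤n)

  rank-< : ∀ {a b} → a <Q b → rank a < rank b
  rank-< = rank-<-bounded _ ℕ.≤-refl

  rank-≤ : ∀ {a b} → a ≤Q b → rank a ≤ rank b
  rank-≤ {a} {b} a≤b with a ≟ b
  ... | yes refl = ℕ.≤-refl
  ... | no  a≢b  = ℕ.<⇒≤ (rank-< (a≤b , a≢b))

  inHalfOpen-rank : ∀ {a t b} → T (inHalfOpen Q a t b) → rank t ∸ rank a < rank b ∸ rank a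
  inHalfOpen-rank x = let a≤t , t<b = inHalfOpen⁻ x in ℕ.∸-monoˡ-< (rank-< t<b) (rank-≤ a≤t)

  gFuel-rank-zero : ∀ m a b → rank b ∸ rank a ≡ 0 → gFuel Q (suc m) a b ≈ pone
  gFuel-rank-zero m a b eq k rewrite eq = refl

  -- hFuel m a b is hWith (rank b ∸ rank a ∸ 1) m a b; the exponent is a separate argument so that it can be rewritten alone
  hWith : ℕ → ℕ → Fin card → Fin card → Poly
  hWith e m a b = psum (λ t → if inHalfOpen Q a t b then gFuel Q m a t ⊗ y^ (e ∸ (rank t ∸ rank a)) else pzero)

  gFuel-rank-suc : ∀ m a b {d} → rank b ∸ rank a ≡ suc d → gFuel Q (suc m) a b ≈ gFromH d (hWith d m a b)
  gFuel-rank-suc m a b {d} eq = go (∸≡suc⇒≡+ eq)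
    where
    -- phrased via rank b because rewrite eq also rewrites hypotheses mentioning rank b ∸ rank a
    go : rank b ≡ rank a ℕ.+ suc d → gFuel Q (suc m) a b ≈ gFromH d (hWith d m a b)
    go rb≡ k rewrite eq =
      cong (λ e → gFromH d (hWith e m a b) k) (trans (cong (λ r → r ∸ rank a ∸ 1) rb≡) (cong ℕ.pred (ℕ.m+n∸m≡n (rank a) (suc d))))

  mutual
    gFuel-irrelevant : ∀ m m′ a b → rank b ∸ rank a ≤ m → rank b ∸ rank a ≤ m′ → gFuel Q m a b ≈ gFuel Q m′ a b
    gFuel-irrelevant zero    zero     a b _    _    k = refl
    gFuel-irrelevant zero    (suc m′) a b δ≤0  _    k = sym (gFuel-rank-zero m′ a b (ℕ.n≤0⇒n≡0 δ≤0) k)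
    gFuel-irrelevant (suc m) zero     a b _    δ≤0  k = gFuel-rank-zero m a b (ℕ.n≤0⇒n≡0 δ≤0) k
    gFuel-irrelevant (suc m) (suc m′) a b δ≤m δ≤m′ = by-rank (rank b ∸ rank a) refl
      where
      by-rank : ∀ δ → rank b ∸ rank a ≡ δ → gFuel Q (suc m) a b ≈ gFuel Q (suc m′) a b
      by-rank zero    eq k = trans (gFuel-rank-zero m a b eq k) (sym (gFuel-rank-zero m′ a b eq k))
      by-rank (suc d) eq k = begin
        gFuel Q (suc m) a b k            ≡⟨ gFuel-rank-suc m a b eq k ⟩
        gFromH d (hWith d m a b) k       ≡⟨ gFromH-cong d (hWith-irrelevant d m m′ a b δ≤m δ≤m′) k ⟩
        gFromH d (hWith d m′ a b) k      ≡⟨ gFuel-rank-suc m′ a b eq k ⟨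
        gFuel Q (suc m′) a b k           ∎
        where open ≡-Reasoning

    hWith-irrelevant : ∀ e m m′ a b → rank b ∸ rank a ≤ suc m → rank b ∸ rank a ≤ suc m′ →
                       hWith e m a b ≈ hWith e m′ a b
    hWith-irrelevant e m m′ a b δ≤m δ≤m′ = psum-cong λ t → if-then-≈ (inHalfOpen Q a t b) λ x →
      ⊗-congʳ (y^ (e ∸ (rank t ∸ rank a))) (gFuel-irrelevant m m′ a t (below x δ≤m) (below x δ≤m′))
      where
      below : ∀ {t n} → T (inHalfOpen Q a t b) → rank b ∸ rank a ≤ suc n → rank t ∸ rank a ≤ n
      below x δ≤n = ℕ.≤-pred (ℕ.<-≤-trans (inHalfOpen-rank x) δ≤n)

  muFuel-rank-zero : ∀ m a b → rank b ∸ rank a ≡ 0 → muFuel Q (suc m) a b ≡ muFuel Q 0 a b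
  muFuel-rank-zero m a b δ≡0 with a ≟ b
  ... | yes refl = refl
  ... | no  a≢b with le a b in a≤b
  ...   | true  = contradiction δ≡0 (ℕ.m>n⇒m∸n≢0 (rank-< (from T-≡ a≤b , a≢b)))
  ...   | false = refl

  muFuel-irrelevant : ∀ m m′ a b → rank b ∸ rank a ≤ m → rank b ∸ rank a ≤ m′ → muFuel Q m a b ≡ muFuel Q m′ a b
  muFuel-irrelevant zero    zero     a b _   _    = refl
  muFuel-irrelevant zero    (suc m′) a b δ≤0 _    = sym (muFuel-rank-zero m′ a b (ℕ.n≤0⇒n≡0 δ≤0))
  muFuel-irrelevant (suc m) zero     a b _   δ≤0  = muFuel-rank-zero m a b (ℕ.n≤0⇒n≡0 δ≤0)
  muFuel-irrelevant (suc m) (suc m′) a b δ≤m δ≤m′ with _==_ Q a b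
  ... | true  = refl
  ... | false with le a b
  ...   | true  = cong -_ (sumFin-cong λ c → if-then-cong (inHalfOpen Q a c b) λ x →
                    muFuel-irrelevant m m′ a c (ℕ.≤-pred (ℕ.<-≤-trans (inHalfOpen-rank x) δ≤m))
                                               (ℕ.≤-pred (ℕ.<-≤-trans (inHalfOpen-rank x) δ≤m′)))
  ...   | false = refl

  mu-unfold : ∀ {a b} → a <Q b → mu Q a b ≡ - sumFin (λ c → if inHalfOpen Q a c b then mu Q a c else + 0)
  mu-unfold {a} {b} (a≤b , a≢b) = by-rank (rank b ∸ rank a) refl
    where
    unfold : ∀ m → rank b ∸ rank a ≡ suc m → muFuel Q (suc m) a b ≡ - sumFin (λ c → if inHalfOpen Q a c b then mu Q a c else + 0)
    unfold m eq rewrite ==-≢ a≢b | to T-≡ a≤b = cong -_ (sumFin-cong λ c → if-then-cong (inHalfOpen Q a c b) λ x →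
      muFuel-irrelevant m (rank c ∸ rank a) a c (ℕ.≤-pred (subst (rank c ∸ rank a <_) eq (inHalfOpen-rank x))) ℕ.≤-refl)
    by-rank : ∀ δ → rank b ∸ rank a ≡ δ → mu Q a b ≡ - sumFin (λ c → if inHalfOpen Q a c b then mu Q a c else + 0)
    by-rank zero    eq = contradiction eq (ℕ.m>n⇒m∸n≢0 (rank-< (a≤b , a≢b)))
    by-rank (suc m) eq = trans (cong (λ δ → muFuel Q δ a b) eq) (unfold m eq)

  G H : Fin card → Poly
  G t = gHat Q bot t
  H t = hHat Q bot t

  infix 4 _<ᵇQ_
  _<ᵇQ_ : Fin card → Fin card → Bool
  t <ᵇQ b = inHalfOpen Q bot t b

  <ᵇQ⇒<Q : ∀ {t b} → T (t <ᵇQ b) → t <Q b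
  <ᵇQ⇒<Q = proj₂ ∘ inHalfOpen⁻

  <Q⇒<ᵇQ : ∀ {t b} → t <Q b → T (t <ᵇQ b)
  <Q⇒<ᵇQ = inHalfOpen⁺ (bot-le _)

  rank-below : ∀ {t b d} → rank b ≡ suc d → t <Q b → rank t ≤ d
  rank-below {t} rb≡ t<b = ℕ.≤-pred (subst (rank t <_) rb≡ (rank-< t<b))

  rank-from-bot : ∀ {b d} → rank b ≡ suc d → rank b ∸ rank bot ≡ suc d
  rank-from-bot rb≡ = cong₂ _∸_ rb≡ rank-bot

  H-expand : ∀ {b d} → rank b ≡ suc d → H b ≈ psum (λ t → if t <ᵇQ b then G t ⊗ y^ (d ∸ rank t) else pzero)
  H-expand {b} {d} rb≡ = psum-cong λ t → if-then-≈ (t <ᵇQ b) λ t<b →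
    ⊗-cong (gFuel-irrelevant _ _ bot t (ℕ.<⇒≤ (inHalfOpen-rank t<b)) ℕ.≤-refl) (λ k → cong (λ e → y^ e k) (exponent t))
    where
    exponent : ∀ t → rank b ∸ rank bot ∸ 1 ∸ (rank t ∸ rank bot) ≡ d ∸ rank t
    exponent t rewrite rank-bot | rb≡ = refl

  G-expand : ∀ {b d} → rank b ≡ suc d → G b ≈ gFromH d (H b)
  G-expand {b} {d} rb≡ k = begin
    gFuel Q (rank b ∸ rank bot) bot b k         ≡⟨ gFuel-irrelevant _ (suc d) bot b ℕ.≤-refl (ℕ.≤-reflexive δ≡) k ⟩
    gFuel Q (suc d) bot b k                     ≡⟨ gFuel-rank-suc d bot b δ≡ k ⟩
    gFromH d (hWith d d bot b) k                ≡⟨ gFromH-cong d same-h k ⟩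
    gFromH d (H b) k                            ∎
    where
    open ≡-Reasoning
    δ≡ : rank b ∸ rank bot ≡ suc d
    δ≡ = rank-from-bot rb≡
    same-h : hWith d d bot b ≈ H b
    same-h j = trans (hWith-irrelevant d d _ bot b (ℕ.≤-reflexive δ≡) (ℕ.n≤1+n _) j)
                     (cong (λ e → hWith e (rank b ∸ rank bot) bot b j) (cong ℕ.pred (sym δ≡)))

  G-rank-zero : ∀ {t} → rank t ≡ 0 → G t ≈ pone
  G-rank-zero {t} rt≡0 = gFuel-irrelevant _ 0 bot t ℕ.≤-refl (ℕ.≤-reflexive (cong₂ _∸_ rt≡0 rank-bot))

  Deg≤-G : ∀ t → Deg≤ (rank t) (G t)
  Deg≤-G t = by-rank (rank t) refl
    where
    by-rank : ∀ n → rank t ≡ n → Deg≤ (rank t) (G t)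
    by-rank zero    rt≡0 k 0<k = trans (G-rank-zero rt≡0 k) (one-const k (subst (_< k) rt≡0 0<k))
      where
      one-const : ∀ k → 0 < k → pone k ≡ + 0
      one-const (suc k) _ = refl
    by-rank (suc d) rt≡ k rt<k = trans (G-expand rt≡ k)
      (gFromH-high d (H t) k (ℕ.≤-<-trans (ℕ.⌊n/2⌋≤n d) (ℕ.<-trans (ℕ.n<1+n d) (subst (_< k) rt≡ rt<k))))

  Deg≤-H : ∀ {b d} → rank b ≡ suc d → Deg≤ d (H b)
  Deg≤-H {b} {d} rb≡ = Deg≤-cong (λ k → sym (H-expand rb≡ k)) (Deg≤-psum _ λ t → Deg≤-if (t <ᵇQ b) _ λ t<b →
    subst (λ n → Deg≤ n (G t ⊗ y^ (d ∸ rank t))) (ℕ.m+[n∸m]≡n (rank-below rb≡ (<ᵇQ⇒<Q t<b))) (Deg≤-⊗ (Deg≤-G t) (Deg≤-y^ (d ∸ rank t))))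

  lowerSum : Fin card → Poly
  lowerSum t = psum (λ s → if le s t then G s ⊗ y^ (rank t ∸ rank s) else pzero)

  Reflects : Fin card → Set
  Reflects t = reflect (rank t) (G t) ≈ lowerSum t

  le-split : ∀ s b (w : ℤ) → (if le s b then w else + 0) ≡ (if _==_ Q s b then w else + 0) + (if s <ᵇQ b then w else + 0)
  le-split s b w with s ≟ b
  ... | yes refl rewrite to T-≡ (le-refl s) | to T-≡ (bot-le s) = sym (ℤ.+-identityʳ w)
  ... | no  s≢b  rewrite to T-≡ (bot-le s) with le s b
  ...   | true  = sym (ℤ.+-identityˡ w)
  ...   | false = refl

  xm1⊗H : ∀ {b d} → rank b ≡ suc d → xm1 ⊗ H b ≈ psum (λ s → if s <ᵇQ b then G s ⊗ y^ (rank b ∸ rank s) else pzero)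
  xm1⊗H {b} {d} rb≡ k = begin
    (xm1 ⊗ H b) k                                            ≡⟨ ⊗-congˡ xm1 (H-expand rb≡) k ⟩
    (xm1 ⊗ psum f) k                                         ≡⟨ ⊗-comm xm1 (psum f) k ⟩
    (psum f ⊗ xm1) k                                         ≡⟨ psum-⊗ f xm1 k ⟩
    sumFin (λ s → (f s ⊗ xm1) k)                             ≡⟨ sumFin-cong (λ s → trans (if-⊗ (s <ᵇQ b) _ xm1 k) (step s k)) ⟩
    psum (λ s → if s <ᵇQ b then G s ⊗ y^ (rank b ∸ rank s) else pzero) k ∎
    where
    open ≡-Reasoning
    f : Fin card → Poly
    f s = if s <ᵇQ b then G s ⊗ y^ (d ∸ rank s) else pzero
    step : ∀ s → (if s <ᵇQ b then (G s ⊗ y^ (d ∸ rank s)) ⊗ xm1 else pzero) ≈ (if s <ᵇQ b then G s ⊗ y^ (rank b ∸ rank s) else pzero)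
    step s = if-then-≈ (s <ᵇQ b) λ s<b j → begin
      ((G s ⊗ y^ (d ∸ rank s)) ⊗ xm1) j         ≡⟨ ⊗-comm (G s ⊗ y^ (d ∸ rank s)) xm1 j ⟩
      (xm1 ⊗ (G s ⊗ y^ (d ∸ rank s))) j         ≡⟨ ⊗-xm1⊗ (G s) (y^ (d ∸ rank s)) j ⟨
      (G s ⊗ y^ (suc (d ∸ rank s))) j           ≡⟨ cong (λ e → (G s ⊗ y^ e) j) (sym (ℕ.+-∸-assoc 1 (rank-below rb≡ (<ᵇQ⇒<Q s<b)))) ⟩
      (G s ⊗ y^ (suc d ∸ rank s)) j             ≡⟨ cong (λ e → (G s ⊗ y^ (e ∸ rank s)) j) (sym rb≡) ⟩
      (G s ⊗ y^ (rank b ∸ rank s)) j            ∎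

  lowerSum-split : ∀ {b d} → rank b ≡ suc d → lowerSum b ≈ G b ⊕ (xm1 ⊗ H b)
  lowerSum-split {b} rb≡ k = begin
    lowerSum b k
      ≡⟨ sumFin-cong (λ s → trans (if-float (_$ k) (le s b)) (le-split s b (w s))) ⟩
    sumFin (λ s → (if _==_ Q s b then w s else + 0) + (if s <ᵇQ b then w s else + 0))
      ≡⟨ sumFin-distrib-+ (λ s → if _==_ Q s b then w s else + 0) (λ s → if s <ᵇQ b then w s else + 0) ⟩
    sumFin (λ s → if _==_ Q s b then w s else + 0) + sumFin (λ s → if s <ᵇQ b then w s else + 0)
      ≡⟨ cong₂ _+_ top-term (sym (trans (xm1⊗H rb≡ k) (sumFin-cong (λ s → if-float (_$ k) (s <ᵇQ b))))) ⟩
    G b k + (xm1 ⊗ H b) k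
      ∎
    where
    open ≡-Reasoning
    w : Fin card → ℤ
    w s = (G s ⊗ y^ (rank b ∸ rank s)) k
    top-term : sumFin (λ s → if _==_ Q s b then w s else + 0) ≡ G b k
    top-term = begin
      sumFin (λ s → if _==_ Q s b then w s else + 0)   ≡⟨ sumFin-single b _ (λ s s≢b → cong (if_then w s else + 0) (==-≢ s≢b)) ⟩
      (if _==_ Q b b then w b else + 0)                ≡⟨ cong (if_then w b else + 0) (==-refl b) ⟩
      (G b ⊗ y^ (rank b ∸ rank b)) k                   ≡⟨ cong (λ e → (G b ⊗ y^ e) k) (ℕ.n∸n≡0 (rank b)) ⟩
      (G b ⊗ pone) k                                   ≡⟨ ⊗-identityʳ (G b) k ⟩
      G b k                                            ∎

  <ᵇQ-∧-le : ∀ b s t → ((t <ᵇQ b) ∧ le s t) ≡ ((s <ᵇQ b) ∧ inHalfOpen Q s t b)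
  <ᵇQ-∧-le b s t = does-⇔ (mk⇔ forward backward) (T? _) (T? _)
    where
    forward : T ((t <ᵇQ b) ∧ le s t) → T ((s <ᵇQ b) ∧ inHalfOpen Q s t b)
    forward x with to T-∧ x
    ... | t<b , s≤t with <ᵇQ⇒<Q t<b
    ...   | t≤b , t≢b = from T-∧ (<Q⇒<ᵇQ (le-trans s t b s≤t t≤b , s≢b) , inHalfOpen⁺ s≤t (t≤b , t≢b))
      where
      s≢b : s ≢ b
      s≢b refl = t≢b (le-antisym t s t≤b s≤t)
    backward : T ((s <ᵇQ b) ∧ inHalfOpen Q s t b) → T ((t <ᵇQ b) ∧ le s t)
    backward x with inHalfOpen⁻ (proj₂ (to (T-∧ {s <ᵇQ b}) x))
    ... | s≤t , t<b = from T-∧ (<Q⇒<ᵇQ t<b , s≤t)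

  module LowerReflection {b d} (rb≡ : rank b ≡ suc d) (IH : ∀ t → t <Q b → Reflects t) (k : ℕ) where

    Z : Fin card → ℤ
    Z s = (G s ⊗ y^ (d ∸ rank s)) k

    κ : Fin card → ℤ
    κ s = sumFin (λ t → if inHalfOpen Q s t b then sgn (d ∸ rank t) else + 0)

    term-reflect : ∀ t → T (t <ᵇQ b) →
                   reflect d (G t ⊗ y^ (d ∸ rank t)) k ≡ sgn (d ∸ rank t) * sumFin (λ s → if le s t then Z s else + 0)
    term-reflect t t<b = begin
      reflect d (G t ⊗ y^ m) k                                 ≡⟨ cong (λ n → reflect n (G t ⊗ y^ m) k) (sym (ℕ.m+[n∸m]≡n rt≤d)) ⟩
      reflect (rank t ℕ.+ m) (G t ⊗ y^ m) k                    ≡⟨ reflect-⊗-y^ (rank t) m (Deg≤-G t) k ⟩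
      sgn m * (reflect (rank t) (G t) ⊗ y^ m) k                ≡⟨ cong (sgn m *_) (⊗-congʳ (y^ m) (IH t (<ᵇQ⇒<Q t<b)) k) ⟩
      sgn m * (lowerSum t ⊗ y^ m) k                            ≡⟨ cong (sgn m *_) (psum-⊗ (λ s → if le s t then G s ⊗ y^ (rank t ∸ rank s) else pzero) (y^ m) k) ⟩
      sgn m * sumFin (λ s → ((if le s t then G s ⊗ y^ (rank t ∸ rank s) else pzero) ⊗ y^ m) k)
                                                               ≡⟨ cong (sgn m *_) (sumFin-cong term) ⟩
      sgn m * sumFin (λ s → if le s t then Z s else + 0)       ∎
      where
      open ≡-Reasoning
      m : ℕ
      m = d ∸ rank t
      rt≤d : rank t ≤ d
      rt≤d = rank-below rb≡ (<ᵇQ⇒<Q t<b)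
      term : ∀ s → ((if le s t then G s ⊗ y^ (rank t ∸ rank s) else pzero) ⊗ y^ m) k ≡ (if le s t then Z s else + 0)
      term s = trans (if-⊗ (le s t) _ (y^ m) k) (trans (if-float (_$ k) (le s t)) (if-then-cong (le s t) λ s≤t →
        trans (⊗-y^-+ (G s) (rank t ∸ rank s) m k)
              (cong (λ e → (G s ⊗ y^ e) k) (trans (ℕ.+-comm (rank t ∸ rank s) m) (sym (∸-split (rank-≤ s≤t) rt≤d))))))

    reflect-H : reflect d (H b) k ≡ sumFin (λ s → if s <ᵇQ b then κ s * Z s else + 0)
    reflect-H = begin
      reflect d (H b) k
        ≡⟨ trans (reflect-cong d (H-expand rb≡) k) (reflect-psum d (λ t → if t <ᵇQ b then G t ⊗ y^ (d ∸ rank t) else pzero) k) ⟩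
      sumFin (λ t → reflect d (if t <ᵇQ b then G t ⊗ y^ (d ∸ rank t) else pzero) k)
        ≡⟨ sumFin-cong (λ t → trans (reflect-if d (t <ᵇQ b) _ k) (trans (if-float (_$ k) (t <ᵇQ b)) (if-then-cong (t <ᵇQ b) (term-reflect t)))) ⟩
      sumFin (λ t → if t <ᵇQ b then sgn (d ∸ rank t) * sumFin (λ s → if le s t then Z s else + 0) else + 0)
        ≡⟨ sumFin-cong distribute ⟩
      sumFin (λ t → sumFin (λ s → if (t <ᵇQ b) ∧ le s t then sgn (d ∸ rank t) * Z s else + 0))
        ≡⟨ sumFin-comm (λ t s → if (t <ᵇQ b) ∧ le s t then sgn (d ∸ rank t) * Z s else + 0) ⟩
      sumFin (λ s → sumFin (λ t → if (t <ᵇQ b) ∧ le s t then sgn (d ∸ rank t) * Z s else + 0))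
        ≡⟨ sumFin-cong collect ⟩
      sumFin (λ s → if s <ᵇQ b then κ s * Z s else + 0)
        ∎
      where
      open ≡-Reasoning
      if-*ʳ : ∀ β x c → (if β then x * c else + 0) ≡ (if β then x else + 0) * c
      if-*ʳ true  x c = refl
      if-*ʳ false x c = sym (ℤ.*-zeroˡ c)
      distribute : ∀ t → (if t <ᵇQ b then sgn (d ∸ rank t) * sumFin (λ s → if le s t then Z s else + 0) else + 0)
                         ≡ sumFin (λ s → if (t <ᵇQ b) ∧ le s t then sgn (d ∸ rank t) * Z s else + 0)
      distribute t with t <ᵇQ b
      ... | true  = trans (*-distribˡ-sumFin (sgn (d ∸ rank t)) (λ s → if le s t then Z s else + 0))
                          (sumFin-cong λ s → *-if (sgn (d ∸ rank t)) (le s t) (Z s))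
      ... | false = sym (sumFin-≡0 {f = λ s → if false ∧ le s t then sgn (d ∸ rank t) * Z s else + 0} (λ _ → refl))
      collect : ∀ s → sumFin (λ t → if (t <ᵇQ b) ∧ le s t then sgn (d ∸ rank t) * Z s else + 0)
                      ≡ (if s <ᵇQ b then κ s * Z s else + 0)
      collect s = trans (sumFin-cong λ t → cong (if_then sgn (d ∸ rank t) * Z s else + 0) (<ᵇQ-∧-le b s t)) (by-cases (s <ᵇQ b))
        where
        by-cases : ∀ β → sumFin (λ t → if β ∧ inHalfOpen Q s t b then sgn (d ∸ rank t) * Z s else + 0) ≡ (if β then κ s * Z s else + 0)
        by-cases true  = trans (sumFin-cong λ t → if-*ʳ (inHalfOpen Q s t b) (sgn (d ∸ rank t)) (Z s))
                               (sym (*-distribʳ-sumFin (Z s) (λ t → if inHalfOpen Q s t b then sgn (d ∸ rank t) else + 0)))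
        by-cases false = sumFin-≡0 {f = λ t → if false ∧ inHalfOpen Q s t b then sgn (d ∸ rank t) * Z s else + 0} (λ _ → refl)

    H-as-sum : H b k ≡ sumFin (λ s → if s <ᵇQ b then Z s else + 0)
    H-as-sum = trans (H-expand rb≡ k) (sumFin-cong λ s → if-float (_$ k) (s <ᵇQ b))

    reflect-H-defect : reflect d (H b) k ≡ H b k + sumFin (λ s → if s <ᵇQ b then (κ s - + 1) * Z s else + 0)
    reflect-H-defect = begin
      reflect d (H b) k
        ≡⟨ reflect-H ⟩
      sumFin (λ s → if s <ᵇQ b then κ s * Z s else + 0)
        ≡⟨ sumFin-cong (λ s → split (s <ᵇQ b) (κ s) (Z s)) ⟩
      sumFin (λ s → (if s <ᵇQ b then Z s else + 0) + (if s <ᵇQ b then (κ s - + 1) * Z s else + 0))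
        ≡⟨ sumFin-distrib-+ (λ s → if s <ᵇQ b then Z s else + 0) (λ s → if s <ᵇQ b then (κ s - + 1) * Z s else + 0) ⟩
      sumFin (λ s → if s <ᵇQ b then Z s else + 0) + sumFin (λ s → if s <ᵇQ b then (κ s - + 1) * Z s else + 0)
        ≡⟨ cong (_+ sumFin (λ s → if s <ᵇQ b then (κ s - + 1) * Z s else + 0)) H-as-sum ⟨
      H b k + sumFin (λ s → if s <ᵇQ b then (κ s - + 1) * Z s else + 0)
        ∎
      where
      open ≡-Reasoning
      split : ∀ β κ z → (if β then κ * z else + 0) ≡ (if β then z else + 0) + (if β then (κ - + 1) * z else + 0)
      split true  κ z = lemma κ z
        where
        lemma : ∀ κ z → κ * z ≡ z + (κ - + 1) * z
        lemma = solve-∀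
      split false κ z = refl

    module _ (eulerian-below : ∀ s c → s ≤Q c → c <Q b → mu Q s c ≡ sgn (rank c ∸ rank s)) where

      κ≡μ : ∀ {s} → s <Q b → κ s ≡ sgn (d ∸ rank s) * - mu Q s b
      κ≡μ {s} s<b = begin
        κ s
          ≡⟨ sumFin-cong (λ t → if-then-cong (inHalfOpen Q s t b) (sign-via-μ t)) ⟩
        sumFin (λ t → if inHalfOpen Q s t b then sgn (d ∸ rank s) * mu Q s t else + 0)
          ≡⟨ sumFin-cong (λ t → sym (*-if (sgn (d ∸ rank s)) (inHalfOpen Q s t b) (mu Q s t))) ⟩
        sumFin (λ t → sgn (d ∸ rank s) * (if inHalfOpen Q s t b then mu Q s t else + 0))
          ≡⟨ *-distribˡ-sumFin (sgn (d ∸ rank s)) (λ t → if inHalfOpen Q s t b then mu Q s t else + 0) ⟨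
        sgn (d ∸ rank s) * sumFin (λ t → if inHalfOpen Q s t b then mu Q s t else + 0)
          ≡⟨ cong (sgn (d ∸ rank s) *_) (trans (sym (ℤ.neg-involutive _)) (cong -_ (sym (mu-unfold s<b)))) ⟩
        sgn (d ∸ rank s) * - mu Q s b
          ∎
        where
        open ≡-Reasoning
        sign-via-μ : ∀ t → T (inHalfOpen Q s t b) → sgn (d ∸ rank t) ≡ sgn (d ∸ rank s) * mu Q s t
        sign-via-μ t x = let s≤t , t<b = inHalfOpen⁻ x in
          trans (sgn-∸-shift (rank-≤ s≤t) (rank-below rb≡ t<b)) (cong (sgn (d ∸ rank s) *_) (sym (eulerian-below s t s≤t t<b)))

      κ≡1 : ∀ {s} → s <Q b → mu Q s b ≡ sgn (rank b ∸ rank s) → κ s ≡ + 1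
      κ≡1 {s} s<b μ≡ = begin
        κ s                                          ≡⟨ κ≡μ s<b ⟩
        sgn (d ∸ rank s) * - mu Q s b                ≡⟨ cong (λ μ → sgn (d ∸ rank s) * - μ) (trans μ≡ (cong sgn ρb∸ρs)) ⟩
        sgn (d ∸ rank s) * - - sgn (d ∸ rank s)      ≡⟨ cong (sgn (d ∸ rank s) *_) (ℤ.neg-involutive _) ⟩
        sgn (d ∸ rank s) * sgn (d ∸ rank s)          ≡⟨ sgn-square (d ∸ rank s) ⟩
        + 1                                          ∎
        where
        open ≡-Reasoning
        ρb∸ρs : rank b ∸ rank s ≡ suc (d ∸ rank s)
        ρb∸ρs = trans (cong (_∸ rank s) rb≡) (ℕ.+-∸-assoc 1 (rank-below rb≡ s<b))

  Eulerian : Fin card → Set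
  Eulerian t = ∀ s c → s ≤Q c → c ≤Q t → mu Q s c ≡ sgn (rank c ∸ rank s)

  Eulerian-mono : ∀ {u t} → u ≤Q t → Eulerian t → Eulerian u
  Eulerian-mono {u} {t} u≤t eul s c s≤c c≤u = eul s c s≤c (le-trans c u t c≤u u≤t)

  rank-zero⇒bot : ∀ {t} → rank t ≡ 0 → t ≡ bot
  rank-zero⇒bot {t} rt≡0 with t ≟ bot
  ... | yes t≡bot = t≡bot
  ... | no  t≢bot = contradiction (subst₂ _<_ rank-bot rt≡0 (rank-< (bot-le t , t≢bot ∘ sym))) ℕ.n≮0

  reflects-bot : Reflects bot
  reflects-bot k = begin
    reflect (rank bot) (G bot) k                     ≡⟨ cong (λ n → reflect n (G bot) k) rank-bot ⟩
    reflect 0 (G bot) k                              ≡⟨ reflect-zero (subst (λ n → Deg≤ n (G bot)) rank-bot (Deg≤-G bot)) k ⟩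
    G bot k                                          ≡⟨ ⊗-identityʳ (G bot) k ⟨
    (G bot ⊗ pone) k                                 ≡⟨ cong (λ e → (G bot ⊗ y^ e) k) (ℕ.n∸n≡0 (rank bot)) ⟨
    (G bot ⊗ y^ (rank bot ∸ rank bot)) k             ≡⟨ cong (if_then (G bot ⊗ y^ (rank bot ∸ rank bot)) k else + 0) (to T-≡ (le-refl bot)) ⟨
    (if le bot bot then (G bot ⊗ y^ (rank bot ∸ rank bot)) k else + 0)
                                                     ≡⟨ sumFin-single bot _ off-bot ⟨
    sumFin (λ s → if le s bot then (G s ⊗ y^ (rank bot ∸ rank s)) k else + 0)
                                                     ≡⟨ sumFin-cong (λ s → if-float (_$ k) (le s bot)) ⟨
    lowerSum bot k                                   ∎
    where
    open ≡-Reasoning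
    off-bot : ∀ s → s ≢ bot → (if le s bot then (G s ⊗ y^ (rank bot ∸ rank s)) k else + 0) ≡ + 0
    off-bot s s≢bot = if-then-≡0 (le s bot) λ s≤bot → contradiction (le-antisym s bot s≤bot (bot-le s)) s≢bot

  reflects-step : ∀ {b d} → rank b ≡ suc d → Eulerian b → (∀ t → t <Q b → Reflects t) → Reflects b
  reflects-step {b} {d} rb≡ eul IH k = begin
    reflect (rank b) (G b) k                          ≡⟨ cong (λ n → reflect n (G b) k) rb≡ ⟩
    reflect (suc d) (G b) k                           ≡⟨ reflect-cong (suc d) (G-expand rb≡) k ⟩
    reflect (suc d) (gFromH d (H b)) k                ≡⟨ palindromic-reflection d (Deg≤-H rb≡) H-palindromic k ⟨
    gFromH d (H b) k + (xm1 ⊗ H b) k                  ≡⟨ cong (_+ (xm1 ⊗ H b) k) (G-expand rb≡ k) ⟨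
    G b k + (xm1 ⊗ H b) k                             ≡⟨ lowerSum-split rb≡ k ⟨
    lowerSum b k                                      ∎
    where
    open ≡-Reasoning
    H-palindromic : reflect d (H b) ≈ H b
    H-palindromic j = trans (reflect-H-defect) (trans (cong (_+_ (H b j)) (sumFin-≡0 no-defect)) (ℤ.+-identityʳ (H b j)))
      where
      open LowerReflection rb≡ IH j
      no-defect : ∀ s → (if s <ᵇQ b then (κ s - + 1) * Z s else + 0) ≡ + 0
      no-defect s = if-then-≡0 (s <ᵇQ b) λ s<b →
        trans (cong (λ κ → (κ - + 1) * Z s) (κ≡1 (λ s c s≤c c<b → eul s c s≤c (proj₁ c<b)) (<ᵇQ⇒<Q s<b)
                                                 (eul s b (proj₁ (<ᵇQ⇒<Q s<b)) (le-refl b))))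
              (ℤ.*-zeroˡ (Z s))

  reflects-bounded : ∀ n t → rank t ≤ n → Eulerian t → Reflects t
  reflects-bounded n t rt≤n eul = by-rank n (rank t) refl rt≤n
    where
    by-rank : ∀ n δ → rank t ≡ δ → δ ≤ n → Reflects t
    by-rank _       zero    rt≡0 _       = subst Reflects (sym (rank-zero⇒bot rt≡0)) reflects-bot
    by-rank (suc n) (suc d) rt≡  (s≤s d≤n) = reflects-step rt≡ eul λ u u<t →
      reflects-bounded n u (ℕ.≤-pred (ℕ.≤-trans (subst (rank u <_) rt≡ (rank-< u<t)) (s≤s d≤n))) (Eulerian-mono (proj₁ u<t) eul)

  reflects : ∀ t → Eulerian t → Reflects t
  reflects t = reflects-bounded (rank t) t ℕ.≤-refl

  module Top {r} (rank-top : rank top ≡ suc r) (semi : SemiEulerian Q) where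

    c : ℤ
    c = sgn r * - mu Q bot top - + 1

    eulerian-below-top : ∀ s u → s ≤Q u → u <Q top → mu Q s u ≡ sgn (rank u ∸ rank s)
    eulerian-below-top s u s≤u (_ , u≢top) = semi s u s≤u (u≢top ∘ proj₂)

    reflects-below-top : ∀ t → t <Q top → Reflects t
    reflects-below-top t (_ , t≢top) = reflects t λ s u s≤u u≤t →
      semi s u s≤u λ (_ , u≡top) → t≢top (le-antisym t top (le-top t) (subst (_≤Q t) u≡top u≤t))

    bot<top : bot <Q top
    bot<top = bot-le top , λ bot≡top → ℕ.1+n≢0 (trans (sym rank-top) (trans (cong rank (sym bot≡top)) rank-bot))

    ĥ-almost-palindromic : reflect r (H top) ≈ H top ⊕ scale c (y^ r)
    ĥ-almost-palindromic k = trans reflect-H-defect (cong (_+_ (H top k)) (begin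
      sumFin (λ s → if s <ᵇQ top then (κ s - + 1) * Z s else + 0)
        ≡⟨ sumFin-single bot _ off-bot ⟩
      (if bot <ᵇQ top then (κ bot - + 1) * Z bot else + 0)
        ≡⟨ cong (if_then (κ bot - + 1) * Z bot else + 0) (to T-≡ (<Q⇒<ᵇQ bot<top)) ⟩
      (κ bot - + 1) * Z bot
        ≡⟨ cong₂ (λ κ z → (κ - + 1) * z) κ-bot Z-bot ⟩
      c * y^ r k
        ∎))
      where
      open ≡-Reasoning
      open LowerReflection rank-top reflects-below-top k
      off-bot : ∀ s → s ≢ bot → (if s <ᵇQ top then (κ s - + 1) * Z s else + 0) ≡ + 0
      off-bot s s≢bot = if-then-≡0 (s <ᵇQ top) λ s<top →
        trans (cong (λ κ → (κ - + 1) * Z s)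
                    (κ≡1 eulerian-below-top (<ᵇQ⇒<Q s<top) (semi s top (le-top s) (s≢bot ∘ proj₁))))
              (ℤ.*-zeroˡ (Z s))
      κ-bot : κ bot ≡ sgn r * - mu Q bot top
      κ-bot = trans (κ≡μ eulerian-below-top bot<top) (cong (λ n → sgn (r ∸ n) * - mu Q bot top) rank-bot)
      Z-bot : Z bot ≡ y^ r k
      Z-bot = trans (⊗-congʳ (y^ (r ∸ rank bot)) (G-rank-zero rank-bot) k)
                    (trans (⊗-identityˡ (y^ (r ∸ rank bot)) k) (cong (λ n → y^ (r ∸ n) k) rank-bot))

    open AlmostPalindromic r (H top) c (Deg≤-H rank-top) ĥ-almost-palindromic using (defect-even)

    eQ≡ : eQ Q ≡ mu Q bot top + sgn r
    eQ≡ = trans (cong (λ n → mu Q bot top - sgn n) rank-top) (cong (_+_ (mu Q bot top)) (ℤ.neg-involutive (sgn r)))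

    c≡ : c ≡ - (sgn r * eQ Q)
    c≡ = begin
      sgn r * - μ - + 1              ≡⟨ cong (_-_ (sgn r * - μ)) (sgn-square r) ⟨
      sgn r * - μ - sgn r * sgn r    ≡⟨ lemma (sgn r) μ ⟩
      - (sgn r * (μ + sgn r))        ≡⟨ cong (λ e → - (sgn r * e)) eQ≡ ⟨
      - (sgn r * eQ Q)               ∎
      where
      open ≡-Reasoning
      μ : ℤ
      μ = mu Q bot top
      lemma : ∀ σ μ → σ * - μ - σ * σ ≡ - (σ * (μ + σ))
      lemma = solve-∀

    eQ-even : eQ Q * (sgn r + + 1) ≡ + 0
    eQ-even = begin
      e * (σ + + 1)                          ≡⟨ ℤ.*-identityˡ _ ⟨
      + 1 * (e * (σ + + 1))                  ≡⟨ cong (_* (e * (σ + + 1))) (sgn-square r) ⟨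
      σ * σ * (e * (σ + + 1))                ≡⟨ lemma σ e ⟩
      - σ * (- (σ * e) * (σ + + 1))          ≡⟨ cong (λ c′ → - σ * (c′ * (σ + + 1))) c≡ ⟨
      - σ * (c * (σ + + 1))                  ≡⟨ cong (- σ *_) defect-even ⟩
      - σ * + 0                              ≡⟨ ℤ.*-zeroʳ (- σ) ⟩
      + 0                                    ∎
      where
      open ≡-Reasoning
      σ e : ℤ
      σ = sgn r
      e = eQ Q
      lemma : ∀ σ e → σ * σ * (e * (σ + + 1)) ≡ - σ * (- (σ * e) * (σ + + 1))
      lemma = solve-∀

    γ≡ : ∀ k → γ Q r k ≡ - c * y^ (suc r) k
    γ≡ k = begin
      s * n * e                                   ≡⟨ lemma s n e (sgn r) ⟩
      sgn r * e * (- s * n) + s * n * (e * (sgn r + + 1))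
                                                  ≡⟨ cong (λ z → sgn r * e * (- s * n) + s * n * z) eQ-even ⟩
      sgn r * e * (- s * n) + s * n * + 0         ≡⟨ trans (cong (_+_ (sgn r * e * (- s * n))) (ℤ.*-zeroʳ (s * n))) (ℤ.+-identityʳ _) ⟩
      sgn r * e * (- s * n)                       ≡⟨ cong (_* (- s * n)) (trans (sym (ℤ.neg-involutive _)) (cong -_ (sym c≡))) ⟩
      - c * (- s * n)                             ≡⟨ cong (- c *_) (y^-coeff (suc r) k) ⟨
      - c * y^ (suc r) k                          ∎
      where
      open ≡-Reasoning
      s n e : ℤ
      s = sgn (r ℕ.+ k)
      n = + (suc r C k)
      e = eQ Q
      lemma : ∀ x y z w → x * y * z ≡ w * z * (- x * y) + x * y * (z * (w + + 1))
      lemma = solve-∀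

lemma5p8 : (Q : GradedPoset) (r : ℕ) → GradedPoset.rank Q (GradedPoset.top Q) ≡ suc r →
    SemiEulerian Q →
    ∀ (k : ℕ) → (+ 2) * lhs58 Q k ≡ (+ 2) * rhs58 Q r k + twoDelta Q r k
lemma5p8 Q r rank-top semi k = begin
  + 2 * (ĝ Q k + (xm1 ⊗ ĥ Q) k)
    ≡⟨ cong (λ g → + 2 * (g + (xm1 ⊗ ĥ Q) k)) (G-expand rank-top k) ⟩
  + 2 * (gFromH r (ĥ Q) ⊕ (xm1 ⊗ ĥ Q)) k
    ≡⟨ reflection (γ Q r) γ≡ k ⟩
  + 2 * (reflect (suc r) (gFromH r (ĥ Q)) k + gammaSum Q r k) + twoDelta Q r k
    ≡⟨ cong (λ g → + 2 * (g + gammaSum Q r k) + twoDelta Q r k) (reflect-cong (suc r) (λ j → sym (G-expand rank-top j)) k) ⟩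
  + 2 * rhs58 Q r k + twoDelta Q r k
    ∎
  where
  open ≡-Reasoning
  open Graded Q
  open Top rank-top semi
  open AlmostPalindromic r (ĥ Q) c (Deg≤-H rank-top) ĥ-almost-palindromic using (reflection)
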